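{- For every positive integer $n$, the number of facets of $\mathrm{BTP}(n)$ is $\frac{(n-1)(3n-2)}{2}$.
   Context: A TSSCPP boolean triangle of order $n$ is a triangular array $(b_{i,n-j})_{1\le j\le i\le n-1}$ (so $\binom{n}{2}$ entries) with entries in $\{0,1\}$ such that for all $1\le j<i\le n-1$, $$1+\sum_{k=j+1}^{i}b_{k,n-j-1}\ge\sum_{k=j}^{i}b_{k,n-j}.$$ $\mathrm{BTP}(n)$ is the convex hull in $\mathbb{R}^{\binom{n}{2}}$ (coordinates indexed by the positions $(i,n-j)$, $1\le j\le i\le n-1$) of all TSSCPP boolean triangles of order $n$. A facet is a face of dimension one less than the dimension of the polytope. -}

module Defs where

open import Data.Nat as ℕ using (ℕ; zero; suc; _+_; _∸_)
open import Data.Bool using (Bool; true; false)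
open import Data.List using (List; []; _∷_; map; applyUpTo; concatMap; length; foldr; zipWith)
open import Data.List.Relation.Unary.All using (All)
open import Data.List.Relation.Unary.Any using (Any)
open import Data.List.Relation.Unary.AllPairs using (AllPairs)
open import Data.List.Membership.Propositional using (_∈_)
open import Data.Product using (Σ; _×_; _,_; ∃)
open import Data.Rational as ℚ using (ℚ; 0ℚ; 1ℚ)
open import Relation.Binary.PropositionalEquality using (_≡_)
open import Relation.Nullary using (¬_)
open import Function.Bundles using (_⇔_)

range : ℕ → ℕ → List ℕ
range a b = applyUpTo (λ k → a + k) (suc b ∸ a)

sumℕ : List ℕ → ℕ
sumℕ = foldr _+_ 0

sumℚ : List ℚ → ℚ
sumℚ = foldr ℚ._+_ 0ℚ

bℕ : Bool → ℕ
bℕ true  = 1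
bℕ false = 0

bℚ : Bool → ℚ
bℚ true  = 1ℚ
bℚ false = 0ℚ

-- A candidate array: b i j stands for the entry b_{i,n-j}.
-- Only positions (i,j) with 1 ≤ j ≤ i ≤ n-1 are coordinates.
Array : Set
Array = ℕ → ℕ → Bool

positions : ℕ → List (ℕ × ℕ)
positions n = concatMap (λ i → map (λ j → (i , j)) (range 1 i)) (range 1 (n ∸ 1))

IsTSSCPP : ℕ → Array → Set
IsTSSCPP n b = ∀ i j → 1 ℕ.≤ j → j ℕ.< i → i ℕ.≤ n ∸ 1 →
  sumℕ (map (λ k → bℕ (b k j)) (range j i))
    ℕ.≤ 1 + sumℕ (map (λ k → bℕ (b k (suc j))) (range (suc j) i))

Functional : Set
Functional = ℕ → ℕ → ℚ

dot : ℕ → Functional → Array → ℚ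
dot n c x = sumℚ (map (λ { (i , j) → c i j ℚ.* bℚ (x i j) }) (positions n))

AffInd : ℕ → List Array → Set
AffInd n ps = ∀ (ls : List ℚ) → length ls ≡ length ps → sumℚ ls ≡ 0ℚ →
  (∀ {i j} → (i , j) ∈ positions n →
     sumℚ (zipWith (λ l p → l ℚ.* bℚ (p i j)) ls ps) ≡ 0ℚ) →
  All (_≡ 0ℚ) ls

-- the maximal size of an affinely independent family in S is k
-- (so the affine dimension of conv S is k - 1)
AffRank : ℕ → (Array → Set) → ℕ → Set
AffRank n S k =
  (Σ (List Array) λ ps → All S ps × length ps ≡ k × AffInd n ps) ×
  (∀ ps → All S ps → AffInd n ps → length ps ℕ.≤ k)

OnFace : ℕ → Functional × ℚ → Array → Set
OnFace n (c , β) x = IsTSSCPP n x × dot n c x ≡ β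

Valid : ℕ → Functional × ℚ → Set
Valid n (c , β) = ∀ x → IsTSSCPP n x → dot n c x ℚ.≤ β

-- (c , β) defines a facet: a nonempty face whose dimension is dim BTP(n) - 1
DefinesFacet : ℕ → Functional × ℚ → Set
DefinesFacet n h = Valid n h × ∃ λ k → 1 ℕ.≤ k ×
  AffRank n (OnFace n h) k × AffRank n (IsTSSCPP n) (suc k)

-- two valid inequalities define the same face (same vertex set, hence same
-- convex hull)
SameFace : ℕ → Functional × ℚ → Functional × ℚ → Set
SameFace n h h' = ∀ x → IsTSSCPP n x → (OnFace n h x ⇔ OnFace n h' x)

NumFacets : ℕ → ℕ → Set
NumFacets n N = Σ (List (Functional × ℚ)) λ fs →
  length fs ≡ N × All (DefinesFacet n) fs ×
  AllPairs (λ h h' → ¬ SameFace n h h') fs ×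
  (∀ h → DefinesFacet n h → Any (SameFace n h) fs)

-- BTP(n) is full-dimensional (the zero triangle and the unit triangles are vertices), so a valid
-- inequality defines a facet as soon as its face contains d = binom(n,2) affinely independent vertices.
-- For x_q ≥ 0, x_q ≤ 1 and each TSSCPP inequality such vertices are exhibited as a triangular family:
-- each has a 1 at a designated coordinate where all later ones have a 0. Distinct listed inequalities
-- are separated by a vertex lying on only one of their faces.
--
-- Conversely, suppose a facet F lay in none of the listed hyperplanes. Summing, over the listed
-- inequalities, a vertex of F off each of them gives a point Z (of m vertices) satisfying every listed
-- inequality with slack, so for a vertex w off F the integer array Y = (K+1)Z − m w lies in D·Q, where Q
-- is the polytope cut out by the listed inequalities and D = K m. Rounding the partial column sums of
-- Y/D at the offsets t/D (t < D) splits Y into D TSSCPP triangles (Hermite's identity), so the inequality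
-- of F holds at Y/D — which the choice of Y violates. Hence F lies in a listed hyperplane and, being of
-- full rank in it, equals that facet. There are 2·binom(n,2) + binom(n−1,2) = (n−1)(3n−2)/2 of them.

module Submission where

open import Defs
open import Algebra.Bundles using (CommutativeSemiring; CommutativeRing)
open import Data.Bool using (Bool; true; false; if_then_else_)
open import Data.Empty using (⊥; ⊥-elim)
import Data.Integer as ℤ
open import Data.List using (List; []; _∷_; [_]; _++_; _∷ʳ_; map; foldr; length; zipWith; replicate; filter; concatMap; applyUpTo; upTo)
import Data.List.Properties as List
open import Data.List.Membership.Propositional using (_∈_; _∉_; find)
open import Data.List.Membership.Propositional.Properties
open import Data.List.Relation.Unary.All as All using (All; []; _∷_)
import Data.List.Relation.Unary.All.Properties as All
open import Data.List.Relation.Unary.Any as Any using (Any; here; there)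
import Data.List.Relation.Unary.Any.Properties as Any
open import Data.List.Relation.Unary.AllPairs as AllPairs using (AllPairs; []; _∷_)
import Data.List.Relation.Unary.AllPairs.Properties as AllPairs
open import Data.List.Relation.Unary.Unique.Propositional using (Unique)
import Data.List.Relation.Unary.Unique.Propositional.Properties as Unique
open import Data.Nat as ℕ using (ℕ; zero; suc; _+_; _∸_; _*_; _≤_; _/_; z≤n; s≤s)
open import Data.Nat.DivMod using (m*n/n≡m; m<n⇒m/n≡0; /-monoˡ-≤; m/n≡1+[m∸n]/n)
import Data.Nat.Properties as ℕ
import Data.Nat.Solver as ℕ-Solver
open import Data.Product using (Σ-syntax; ∃; _×_; _,_; proj₁; proj₂)
import Data.Product.Properties as Product
open import Data.Product.Relation.Binary.Lex.Strict using (×-Lex)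
open import Data.List.Membership.DecPropositional (Product.≡-dec ℕ._≟_ ℕ._≟_) using (_∈?_)
open import Data.Rational as ℚ using (ℚ; 0ℚ; 1ℚ)
import Data.Rational.Properties as ℚ
import Data.Rational.Solver as ℚ-Solver
open import Algebra.Properties.Semiring.Mult (CommutativeRing.semiring ℚ.+-*-commutativeRing)
  using (×-homo-+; ×1-homo-*) renaming (_×_ to _·_)
open import Data.Sum using (_⊎_; inj₁; inj₂)
open import Function using (_∘_; case_of_)
open import Function.Bundles using (mk⇔; Equivalence)
open import Relation.Binary.Definitions using (DecidableEquality; tri<; tri≈; tri>)
open import Relation.Binary.PropositionalEquality
  using (_≡_; _≢_; refl; sym; trans; cong; cong₂; subst; subst₂; module ≡-Reasoning)
open import Relation.Nullary
open import Relation.Nullary.Decidable using (¬?; dec-true; dec-false; map′)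

module FiniteSum {c ℓ} (R : CommutativeSemiring c ℓ) where

  private module R = CommutativeSemiring R
  open R using (Carrier; _≈_; 0#; +-cong; +-congˡ)
  open import Algebra.Properties.CommutativeSemigroup R.+-commutativeSemigroup using (interchange)

  ∑ : {A : Set} → List A → (A → Carrier) → Carrier
  ∑ xs f = foldr R._+_ 0# (map f xs)

  module _ {A : Set} where

    ∑-cong : (xs : List A) {f g : A → Carrier} → (∀ {x} → x ∈ xs → f x ≈ g x) → ∑ xs f ≈ ∑ xs g
    ∑-cong []       f≈g = R.refl
    ∑-cong (x ∷ xs) f≈g = +-cong (f≈g (here refl)) (∑-cong xs (f≈g ∘ there))

    ∑-zeros : (xs : List A) {f : A → Carrier} → (∀ {x} → x ∈ xs → f x ≈ 0#) → ∑ xs f ≈ 0#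
    ∑-zeros []       f≈0 = R.refl
    ∑-zeros (x ∷ xs) f≈0 = R.trans (+-cong (f≈0 (here refl)) (∑-zeros xs (f≈0 ∘ there))) (R.+-identityˡ 0#)

    ∑-++ : (xs ys : List A) (f : A → Carrier) → ∑ (xs ++ ys) f ≈ ∑ xs f R.+ ∑ ys f
    ∑-++ []       ys f = R.sym (R.+-identityˡ (∑ ys f))
    ∑-++ (x ∷ xs) ys f = R.trans (+-congˡ (∑-++ xs ys f)) (R.sym (R.+-assoc (f x) (∑ xs f) (∑ ys f)))

    ∑-+ : (xs : List A) (f g : A → Carrier) → ∑ xs (λ x → f x R.+ g x) ≈ ∑ xs f R.+ ∑ xs g
    ∑-+ []       f g = R.sym (R.+-identityˡ 0#)
    ∑-+ (x ∷ xs) f g = R.trans (+-congˡ (∑-+ xs f g)) (interchange (f x) (g x) (∑ xs f) (∑ xs g))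

    ∑-*ˡ : (xs : List A) (r : Carrier) (f : A → Carrier) → ∑ xs (λ x → r R.* f x) ≈ r R.* ∑ xs f
    ∑-*ˡ []       r f = R.sym (R.zeroʳ r)
    ∑-*ˡ (x ∷ xs) r f = R.trans (+-congˡ (∑-*ˡ xs r f)) (R.sym (R.distribˡ r (f x) (∑ xs f)))

    ∑-supported : (xs : List A) (q : A) (f : A → Carrier) → Unique xs → q ∈ xs →
                  (∀ {p} → p ∈ xs → p ≢ q → f p ≈ 0#) → ∑ xs f ≈ f q
    ∑-supported (x ∷ xs) q f (x∉xs ∷ _) (here refl) f≈0 =
      R.trans (+-congˡ (∑-zeros xs (λ p∈xs → f≈0 (there p∈xs) (λ p≡q → All.lookup x∉xs p∈xs (sym p≡q)))))
              (R.+-identityʳ (f q))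
    ∑-supported (x ∷ xs) q f (x∉xs ∷ !xs) (there q∈xs) f≈0 =
      R.trans (+-cong (f≈0 (here refl) (All.lookup x∉xs q∈xs)) (∑-supported xs q f !xs q∈xs (f≈0 ∘ there)))
              (R.+-identityˡ (f q))

  ∑-map : {A B : Set} (h : A → B) (xs : List A) (f : B → Carrier) → ∑ (map h xs) f ≈ ∑ xs (f ∘ h)
  ∑-map h []       f = R.refl
  ∑-map h (x ∷ xs) f = +-congˡ (∑-map h xs f)

  ∑-comm : {A B : Set} (xs : List A) (ys : List B) (f : A → B → Carrier) →
           ∑ xs (λ a → ∑ ys (f a)) ≈ ∑ ys (λ b → ∑ xs (λ a → f a b))
  ∑-comm []       ys f = R.sym (∑-zeros ys (λ _ → R.refl))
  ∑-comm (x ∷ xs) ys f = R.trans (+-congˡ (∑-comm xs ys f)) (R.sym (∑-+ ys (f x) (λ b → ∑ xs (λ a → f a b))))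

  module _ {A : Set} (_≟_ : DecidableEquality A)
           (χ : Bool → Carrier) (χ-true : χ true ≈ R.1#) (χ-false : χ false ≈ 0#) where

    open import Data.List.Membership.DecPropositional _≟_ using () renaming (_∈?_ to _∈ᴬ?_)

    private
      χ-∈ : ∀ {x xs} → x ∈ xs → χ (does (x ∈ᴬ? xs)) ≈ R.1#
      χ-∈ {x} {xs} x∈xs = R.trans (R.reflexive (cong χ (dec-true (x ∈ᴬ? xs) x∈xs))) χ-true

      χ-∉ : ∀ {x xs} → x ∉ xs → χ (does (x ∈ᴬ? xs)) ≈ 0#
      χ-∉ {x} {xs} x∉xs = R.trans (R.reflexive (cong χ (dec-false (x ∈ᴬ? xs) x∉xs))) χ-false

      χ-≟ : ∀ {x y} → x ≢ y → χ (does (x ≟ y)) ≈ 0#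
      χ-≟ {x} {y} x≢y = R.trans (R.reflexive (cong χ (dec-false (x ≟ y) x≢y))) χ-false

      χ-≡ : ∀ {x} → χ (does (x ≟ x)) ≈ R.1#
      χ-≡ {x} = R.trans (R.reflexive (cong χ (dec-true (x ≟ x) refl))) χ-true

      χ-∈-∷ : ∀ {x y} xs → x ≢ y → χ (does (x ∈ᴬ? (y ∷ xs))) ≈ χ (does (x ∈ᴬ? xs))
      χ-∈-∷ {x} {y} xs x≢y = by-membership (x ∈ᴬ? xs)
        where
        by-membership : Dec (x ∈ xs) → χ (does (x ∈ᴬ? (y ∷ xs))) ≈ χ (does (x ∈ᴬ? xs))
        by-membership (yes x∈xs) = R.trans (χ-∈ {x} {y ∷ xs} (there x∈xs)) (R.sym (χ-∈ x∈xs))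
        by-membership (no  x∉xs) = R.trans (χ-∉ {x} {y ∷ xs} λ { (here x≡y) → x≢y x≡y ; (there x∈xs) → x∉xs x∈xs }) (R.sym (χ-∉ x∉xs))

    χ-∈≈∑χ-≡ : ∀ x xs → Unique xs → χ (does (x ∈ᴬ? xs)) ≈ ∑ xs (λ y → χ (does (x ≟ y)))
    χ-∈≈∑χ-≡ x []       _             = χ-false
    χ-∈≈∑χ-≡ x (y ∷ xs) (y∉xs ∷ !xs) = by-head (x ≟ y)
      where
      by-head : Dec (x ≡ y) → χ (does (x ∈ᴬ? (y ∷ xs))) ≈ ∑ (y ∷ xs) (λ z → χ (does (x ≟ z)))
      by-head (yes refl) = R.trans (χ-∈ {x} {x ∷ xs} (here refl)) (R.sym (R.trans (+-cong χ-≡ (∑-zeros xs (λ z∈xs → χ-≟ (λ { refl → All.lookup y∉xs z∈xs refl }))))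
                                                                      (R.+-identityʳ R.1#)))
      by-head (no  x≢y)  = R.trans (χ-∈-∷ xs x≢y) (R.trans (χ-∈≈∑χ-≡ x xs !xs) (R.sym (R.trans (+-cong (χ-≟ x≢y) R.refl) (R.+-identityˡ (∑ xs (λ z → χ (does (x ≟ z))))))))

    -- Double counting of the pairs (x, y) with x ∈ xs, y ∈ ys and x ≡ y.
    ∑-χ-∈-swap : ∀ xs ys (f : A → Carrier) → Unique xs → Unique ys →
                 ∑ xs (λ x → χ (does (x ∈ᴬ? ys)) R.* f x) ≈ ∑ ys (λ y → χ (does (y ∈ᴬ? xs)) R.* f y)
    ∑-χ-∈-swap xs ys f !xs !ys = begin
      ∑ xs (λ x → χ (does (x ∈ᴬ? ys)) R.* f x)               ≈⟨ ∑-cong xs (λ {x} _ → R.*-congʳ (χ-∈≈∑χ-≡ x ys !ys)) ⟩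
      ∑ xs (λ x → ∑ ys (λ y → χ (does (x ≟ y))) R.* f x)    ≈⟨ ∑-cong xs (λ {x} _ → R.trans (R.*-comm _ (f x)) (R.sym (∑-*ˡ ys (f x) _))) ⟩
      ∑ xs (λ x → ∑ ys (λ y → f x R.* χ (does (x ≟ y))))    ≈⟨ ∑-comm xs ys _ ⟩
      ∑ ys (λ y → ∑ xs (λ x → f x R.* χ (does (x ≟ y))))    ≈⟨ ∑-cong ys (λ {y} _ → ∑-cong xs (λ {x} _ → diagonal x y)) ⟩
      ∑ ys (λ y → ∑ xs (λ x → f y R.* χ (does (y ≟ x))))    ≈⟨ ∑-cong ys (λ {y} _ → R.trans (∑-*ˡ xs (f y) _) (R.*-comm (f y) _)) ⟩
      ∑ ys (λ y → ∑ xs (λ x → χ (does (y ≟ x))) R.* f y)    ≈⟨ ∑-cong ys (λ {y} _ → R.*-congʳ (R.sym (χ-∈≈∑χ-≡ y xs !xs))) ⟩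
      ∑ ys (λ y → χ (does (y ∈ᴬ? xs)) R.* f y)               ∎
      where
      open import Relation.Binary.Reasoning.Setoid R.setoid
      diagonal : ∀ x y → f x R.* χ (does (x ≟ y)) ≈ f y R.* χ (does (y ≟ x))
      diagonal x y with x ≟ y | y ≟ x
      ... | yes refl | yes _   = R.refl
      ... | yes refl | no  y≢x = ⊥-elim (y≢x refl)
      ... | no  x≢y  | yes refl = ⊥-elim (x≢y refl)
      ... | no  _    | no  _    = R.trans (R.*-congˡ χ-false) (R.trans (R.zeroʳ (f x)) (R.sym (R.trans (R.*-congˡ χ-false) (R.zeroʳ (f y)))))

module ℕ-Sum = FiniteSum ℕ.+-*-commutativeSemiring
module ℚ-Sum = FiniteSum (CommutativeRing.commutativeSemiring ℚ.+-*-commutativeRing)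

open ℕ-Sum using () renaming (∑ to ∑ℕ)
open ℚ-Sum using () renaming (∑ to ∑ℚ)


∑ℚ-neg : {A : Set} (xs : List A) (f : A → ℚ) → ∑ℚ xs (λ x → ℚ.- f x) ≡ ℚ.- ∑ℚ xs f
∑ℚ-neg []       f = refl
∑ℚ-neg (x ∷ xs) f = trans (cong (ℚ.- f x ℚ.+_) (∑ℚ-neg xs f)) (sym (ℚ.neg-distrib-+ (f x) (∑ℚ xs f)))

∑ℚ-mono-≤ : {A : Set} (xs : List A) {f g : A → ℚ} → (∀ {x} → x ∈ xs → f x ℚ.≤ g x) → ∑ℚ xs f ℚ.≤ ∑ℚ xs g
∑ℚ-mono-≤ []       f≤g = ℚ.≤-refl
∑ℚ-mono-≤ (x ∷ xs) f≤g = ℚ.+-mono-≤ (f≤g (here refl)) (∑ℚ-mono-≤ xs (f≤g ∘ there))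

x*y≡0⇒y≡0 : ∀ x y → x ≢ 0ℚ → x ℚ.* y ≡ 0ℚ → y ≡ 0ℚ
x*y≡0⇒y≡0 x y x≢0 xy≡0 = begin
  y                          ≡⟨ ℚ.*-identityˡ y ⟨
  1ℚ ℚ.* y                   ≡⟨ cong (ℚ._* y) (ℚ.*-inverseˡ x) ⟨
  (ℚ.1/ x ℚ.* x) ℚ.* y       ≡⟨ ℚ.*-assoc (ℚ.1/ x) x y ⟩
  ℚ.1/ x ℚ.* (x ℚ.* y)       ≡⟨ cong (ℚ.1/ x ℚ.*_) xy≡0 ⟩
  ℚ.1/ x ℚ.* 0ℚ              ≡⟨ ℚ.*-zeroʳ (ℚ.1/ x) ⟩
  0ℚ                         ∎
  where
  open ≡-Reasoning
  instance _ = ℚ.≢-nonZero x≢0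

*-≢0 : ∀ {x y} → x ≢ 0ℚ → y ≢ 0ℚ → x ℚ.* y ≢ 0ℚ
*-≢0 {x} {y} x≢0 y≢0 = y≢0 ∘ x*y≡0⇒y≡0 x y x≢0

toℚ : ℕ → ℚ
toℚ n = n · 1ℚ

toℚ-+ : ∀ a b → toℚ (a + b) ≡ toℚ a ℚ.+ toℚ b
toℚ-+ = ×-homo-+ 1ℚ

toℚ-* : ∀ a b → toℚ (a * b) ≡ toℚ a ℚ.* toℚ b
toℚ-* = ×1-homo-*

toℚ-∑ : {A : Set} (xs : List A) (f : A → ℕ) → toℚ (∑ℕ xs f) ≡ ∑ℚ xs (toℚ ∘ f)
toℚ-∑ []       f = refl
toℚ-∑ (x ∷ xs) f = trans (toℚ-+ (f x) (∑ℕ xs f)) (cong (toℚ (f x) ℚ.+_) (toℚ-∑ xs f))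

toℚ-positive : ∀ n → 0ℚ ℚ.< toℚ (suc n)
toℚ-positive zero    = ℚ.*<* (ℤ.+<+ (s≤s z≤n))
toℚ-positive (suc n) = ℚ.+-mono-< (toℚ-positive 0) (toℚ-positive n)

toℚ-nonNegative : ∀ n → 0ℚ ℚ.≤ toℚ n
toℚ-nonNegative zero    = ℚ.≤-refl
toℚ-nonNegative (suc n) = ℚ.<⇒≤ (toℚ-positive n)

toℚ-mono-≤ : ∀ {a b} → a ℕ.≤ b → toℚ a ℚ.≤ toℚ b
toℚ-mono-≤ {a} {b} a≤b = subst (toℚ a ℚ.≤_) (trans (sym (toℚ-+ a _)) (cong toℚ (ℕ.m+[n∸m]≡n a≤b)))
  (ℚ.≤-trans (ℚ.≤-reflexive (sym (ℚ.+-identityʳ (toℚ a)))) (ℚ.+-monoʳ-≤ (toℚ a) (toℚ-nonNegative (b ∸ a))))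

toℚ-suc-diff : ∀ b → toℚ (suc b) ℚ.- toℚ b ≡ 1ℚ
toℚ-suc-diff b = solve 1 (λ y → (con 1ℚ :+ y) :- y := con 1ℚ) refl (toℚ b)
  where open ℚ-Solver.+-*-Solver

∑ℚ-const : {A : Set} (xs : List A) (r : ℚ) → ∑ℚ xs (λ _ → r) ≡ toℚ (length xs) ℚ.* r
∑ℚ-const []       r = sym (ℚ.*-zeroˡ r)
∑ℚ-const (x ∷ xs) r = trans (cong₂ ℚ._+_ (sym (ℚ.*-identityˡ r)) (∑ℚ-const xs r))
                             (sym (ℚ.*-distribʳ-+ r 1ℚ (toℚ (length xs))))

bℚ≡toℚ∘bℕ : ∀ b → bℚ b ≡ toℚ (bℕ b)
bℚ≡toℚ∘bℕ true  = refl
bℚ≡toℚ∘bℕ false = refl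

-toℚ≢1 : ∀ b → toℚ 0 ℚ.- toℚ b ≢ 1ℚ
-toℚ≢1 b -b≡1 = ℚ.<-irrefl refl (begin-strict
  1ℚ               ≡⟨ -b≡1 ⟨
  0ℚ ℚ.- toℚ b     ≡⟨ ℚ.+-identityˡ (ℚ.- toℚ b) ⟩
  ℚ.- toℚ b        ≤⟨ ℚ.neg-antimono-≤ (toℚ-nonNegative b) ⟩
  0ℚ               <⟨ toℚ-positive 0 ⟩
  1ℚ               ∎)
  where open ℚ.≤-Reasoning

bℕ≤1 : ∀ b → bℕ b ℕ.≤ 1
bℕ≤1 true  = ℕ.≤-refl
bℕ≤1 false = z≤n

bℚ-nonNegative : ∀ b → 0ℚ ℚ.≤ bℚ b
bℚ-nonNegative true  = ℚ.<⇒≤ (toℚ-positive 0)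
bℚ-nonNegative false = ℚ.≤-refl

bℚ≤1 : ∀ b → bℚ b ℚ.≤ 1ℚ
bℚ≤1 true  = ℚ.≤-refl
bℚ≤1 false = bℚ-nonNegative true

module _ {A : Set} where

  private
    interchange : ∀ a b c → (1 + a) + (b + c) ≡ (1 + b) + (a + c)
    interchange = solve 3 (λ a b c → (con 1 :+ a) :+ (b :+ c) := (con 1 :+ b) :+ (a :+ c)) refl
      where open ℕ-Solver.+-*-Solver

  ∑-≤-length+∑ : ∀ (xs : List A) {f g} → All (λ x → f x ℕ.≤ 1 + g x) xs → ∑ℕ xs f ℕ.≤ length xs + ∑ℕ xs g
  ∑-≤-length+∑ []       []             = z≤n
  ∑-≤-length+∑ (x ∷ xs) {f} {g} (fx≤ ∷ f≤) = ℕ.≤-trans (ℕ.+-mono-≤ fx≤ (∑-≤-length+∑ xs f≤))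
                                                      (ℕ.≤-reflexive (interchange (g x) (length xs) (∑ℕ xs g)))

  ∑-<-length+∑ : ∀ (xs : List A) {f g} → All (λ x → f x ℕ.≤ 1 + g x) xs → Any (λ x → f x ℕ.≤ g x) xs →
                 suc (∑ℕ xs f) ℕ.≤ length xs + ∑ℕ xs g
  ∑-<-length+∑ (x ∷ xs) {f} {g} (_ ∷ f≤) (here fx≤gx) =
    ℕ.≤-trans (ℕ.+-mono-≤ (s≤s fx≤gx) (∑-≤-length+∑ xs f≤)) (ℕ.≤-reflexive (interchange (g x) (length xs) (∑ℕ xs g)))
  ∑-<-length+∑ (x ∷ xs) {f} {g} (fx≤ ∷ f≤) (there slack) =
    ℕ.≤-trans (ℕ.≤-reflexive (sym (ℕ.+-suc (f x) (∑ℕ xs f))))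
              (ℕ.≤-trans (ℕ.+-mono-≤ fx≤ (∑-<-length+∑ xs f≤ slack)) (ℕ.≤-reflexive (interchange (g x) (length xs) (∑ℕ xs g))))

  ∑bℕ≤length : ∀ (xs : List A) (f : A → Bool) → ∑ℕ xs (λ x → bℕ (f x)) ℕ.≤ length xs
  ∑bℕ≤length []       f = z≤n
  ∑bℕ≤length (x ∷ xs) f = ℕ.+-mono-≤ (bℕ≤1 (f x)) (∑bℕ≤length xs f)

  ∑-≥ : ∀ (xs : List A) {f k} → Any (λ x → k ℕ.≤ f x) xs → k ℕ.≤ ∑ℕ xs f
  ∑-≥ (x ∷ xs) {f} (here k≤fx)  = ℕ.≤-trans k≤fx (ℕ.m≤m+n (f x) _)
  ∑-≥ (x ∷ xs) {f} (there k≤∑) = ℕ.≤-trans (∑-≥ xs k≤∑) (ℕ.m≤n+m _ (f x))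

true-unless-false : ∀ b → b ≢ false → b ≡ true
true-unless-false true  _   = refl
true-unless-false false b≢0 = ⊥-elim (b≢0 refl)

false-unless-true : ∀ b → b ≢ true → b ≡ false
false-unless-true true  b≢1 = ⊥-elim (b≢1 refl)
false-unless-true false _   = refl

range-empty : ∀ {a b} → b ℕ.< a → range a b ≡ []
range-empty b<a rewrite ℕ.m≤n⇒m∸n≡0 b<a = refl

range-∷ʳ : ∀ {a b} → a ℕ.≤ suc b → range a (suc b) ≡ range a b ∷ʳ suc b
range-∷ʳ {a} {b} a≤1+b rewrite ℕ.+-∸-assoc 1 a≤1+b =
  trans (sym (List.applyUpTo-∷ʳ (a +_) (suc b ∸ a))) (cong (applyUpTo (a +_) (suc b ∸ a) ∷ʳ_) (ℕ.m+[n∸m]≡n a≤1+b))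

∈-range⁻ : ∀ {a b k} → k ∈ range a b → a ℕ.≤ k × k ℕ.≤ b
∈-range⁻ {a} {b} k∈ with ∈-applyUpTo⁻ (a +_) k∈
... | i , i<len , refl = ℕ.m≤m+n a i , ℕ.≤-pred (begin
  suc (a + i)         ≡⟨ ℕ.+-suc a i ⟨
  a + suc i           ≤⟨ ℕ.+-monoʳ-≤ a i<len ⟩
  a + (suc b ∸ a)     ≡⟨ ℕ.m+[n∸m]≡n {a} (ℕ.<⇒≤ (ℕ.m∸n≢0⇒n<m (ℕ.m<n⇒n≢0 (ℕ.≤-<-trans z≤n i<len)))) ⟩
  suc b               ∎)
  where open ℕ.≤-Reasoning

∈-range⁺ : ∀ {a b k} → a ℕ.≤ k → k ℕ.≤ b → k ∈ range a b
∈-range⁺ {a} {b} a≤k k≤b =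
  subst (_∈ range a b) (ℕ.m+[n∸m]≡n a≤k) (∈-applyUpTo⁺ (a +_) (ℕ.∸-monoˡ-< (s≤s k≤b) a≤k))

range-sorted : ∀ a b → AllPairs ℕ._<_ (range a b)
range-sorted a b = AllPairs.applyUpTo⁺₁ (a +_) (suc b ∸ a) (λ i<j _ → ℕ.+-monoʳ-< a i<j)

range-unique : ∀ a b → Unique (range a b)
range-unique a b = AllPairs.map ℕ.<⇒≢ (range-sorted a b)

length-concatMap : {A B : Set} (f : A → List B) (xs : List A) → length (concatMap f xs) ≡ ∑ℕ xs (length ∘ f)
length-concatMap f []       = refl
length-concatMap f (x ∷ xs) = trans (List.length-++ (f x)) (cong (length (f x) +_) (length-concatMap f xs))

_<ₗₑₓ_ : ℕ × ℕ → ℕ × ℕ → Set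
_<ₗₑₓ_ = ×-Lex _≡_ ℕ._<_ ℕ._<_

<ₗₑₓ⇒≢ : ∀ {p q} → p <ₗₑₓ q → p ≢ q
<ₗₑₓ⇒≢ (inj₁ i<i)        refl = ℕ.<-irrefl refl i<i
<ₗₑₓ⇒≢ (inj₂ (_ , j<j)) refl = ℕ.<-irrefl refl j<j

staircase : (ℕ → ℕ) → ℕ → List (ℕ × ℕ)
staircase w m = concatMap (λ i → map (i ,_) (range 1 (w i))) (range 1 m)

ineqIndices : ℕ → List (ℕ × ℕ)
ineqIndices n = staircase (_∸ 1) (n ∸ 1)

module _ (w : ℕ → ℕ) (m : ℕ) where

  ∈-staircase⁻ : ∀ {i j} → (i , j) ∈ staircase w m → (1 ℕ.≤ i × i ℕ.≤ m) × (1 ℕ.≤ j × j ℕ.≤ w i)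
  ∈-staircase⁻ p∈ with find (∈-concatMap⁻ (λ i → map (i ,_) (range 1 (w i))) p∈)
  ... | i , (i∈ , p∈row) with ∈-map⁻ (i ,_) p∈row
  ...   | j , j∈ , refl = ∈-range⁻ i∈ , ∈-range⁻ j∈

  ∈-staircase⁺ : ∀ {i j} → 1 ℕ.≤ i → i ℕ.≤ m → 1 ℕ.≤ j → j ℕ.≤ w i → (i , j) ∈ staircase w m
  ∈-staircase⁺ 1≤i i≤m 1≤j j≤wi =
    ∈-concatMap⁺ (λ i → map (i ,_) (range 1 (w i))) (Any.map (λ { refl → ∈-map⁺ (_ ,_) (∈-range⁺ 1≤j j≤wi) }) (∈-range⁺ 1≤i i≤m))

  staircase-sorted : AllPairs _<ₗₑₓ_ (staircase w m)
  staircase-sorted = AllPairs.concat⁺ (rows-sorted (range 1 m)) (AllPairs.map⁺ (AllPairs.map rows-ordered (range-sorted 1 m)))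
    where
    rows-sorted : ∀ is → All (AllPairs _<ₗₑₓ_) (map (λ i → map (i ,_) (range 1 (w i))) is)
    rows-sorted []       = []
    rows-sorted (i ∷ is) = AllPairs.map⁺ (AllPairs.map (λ j<j′ → inj₂ (refl , j<j′)) (range-sorted 1 (w i))) ∷ rows-sorted is
    rows-ordered : ∀ {i i′} → i ℕ.< i′ →
                   All (λ p → All (_<ₗₑₓ_ p) (map (i′ ,_) (range 1 (w i′)))) (map (i ,_) (range 1 (w i)))
    rows-ordered i<i′ = All.map⁺ (All.tabulate (λ _ → All.map⁺ (All.tabulate (λ _ → inj₁ i<i′))))

  staircase-unique : Unique (staircase w m)
  staircase-unique = AllPairs.map <ₗₑₓ⇒≢ staircase-sorted

  length-staircase : length (staircase w m) ≡ ∑ℕ (range 1 m) w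
  length-staircase = trans (length-concatMap (λ i → map (i ,_) (range 1 (w i))) (range 1 m))
    (ℕ-Sum.∑-cong (range 1 m) (λ {i} _ → trans (List.length-map (i ,_) (range 1 (w i))) (List.length-applyUpTo (1 +_) (w i))))

_≟²_ : (p q : ℕ × ℕ) → Dec (p ≡ q)
_≟²_ = Product.≡-dec ℕ._≟_ ℕ._≟_

-- positions n unfolds to staircase (λ i → i) (n ∸ 1).
∈-positions⁻ : ∀ {n i j} → (i , j) ∈ positions n → 1 ℕ.≤ j × j ℕ.≤ i × i ℕ.≤ n ∸ 1
∈-positions⁻ {n} p∈ with ∈-staircase⁻ (λ i → i) (n ∸ 1) p∈
... | (_ , i≤) , (1≤j , j≤i) = 1≤j , j≤i , i≤

∈-positions⁺ : ∀ {n i j} → 1 ℕ.≤ j → j ℕ.≤ i → i ℕ.≤ n ∸ 1 → (i , j) ∈ positions n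
∈-positions⁺ {n} 1≤j j≤i i≤ = ∈-staircase⁺ (λ i → i) (n ∸ 1) (ℕ.≤-trans 1≤j j≤i) i≤ 1≤j j≤i

positions-unique : ∀ n → Unique (positions n)
positions-unique n = staircase-unique (λ i → i) (n ∸ 1)

∈-ineqIndices⁻ : ∀ {n i j} → (i , j) ∈ ineqIndices n → 1 ℕ.≤ j × j ℕ.< i × i ℕ.≤ n ∸ 1
∈-ineqIndices⁻ {n} p∈ with ∈-staircase⁻ (_∸ 1) (n ∸ 1) p∈
... | (1≤i , i≤) , (1≤j , j≤i-1) = 1≤j , ℕ.≤-trans (s≤s j≤i-1) (ℕ.≤-reflexive (ℕ.suc-pred _ {{ℕ.>-nonZero 1≤i}})) , i≤

∈-ineqIndices⁺ : ∀ {n i j} → 1 ℕ.≤ j → j ℕ.< i → i ℕ.≤ n ∸ 1 → (i , j) ∈ ineqIndices n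
∈-ineqIndices⁺ {n} {suc i} 1≤j (s≤s j≤i) i≤ = ∈-staircase⁺ (_∸ 1) (n ∸ 1) (s≤s z≤n) i≤ 1≤j j≤i

ineqIndices-unique : ∀ n → Unique (ineqIndices n)
ineqIndices-unique n = staircase-unique (_∸ 1) (n ∸ 1)

positionsExcept : ℕ → ℕ × ℕ → List (ℕ × ℕ)
positionsExcept n p₀ = filter (¬? ∘ (_≟² p₀)) (positions n)

module _ {n : ℕ} {p₀ : ℕ × ℕ} where

  ∈-positionsExcept⁺ : ∀ {q} → q ∈ positions n → q ≢ p₀ → q ∈ positionsExcept n p₀
  ∈-positionsExcept⁺ = ∈-filter⁺ (¬? ∘ (_≟² p₀))

  ∈-positionsExcept⁻ : ∀ {q} → q ∈ positionsExcept n p₀ → q ∈ positions n × q ≢ p₀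
  ∈-positionsExcept⁻ = ∈-filter⁻ (¬? ∘ (_≟² p₀))

  positionsExcept-sorted : AllPairs _<ₗₑₓ_ (positionsExcept n p₀)
  positionsExcept-sorted = AllPairs.filter⁺ (¬? ∘ (_≟² p₀)) (staircase-sorted (λ i → i) (n ∸ 1))

AllPairs-map∈ : ∀ {A : Set} {R S : A → A → Set} {xs} → AllPairs R xs →
                (∀ {a b} → a ∈ xs → b ∈ xs → R a b → S a b) → AllPairs S xs
AllPairs-map∈ []       f = []
AllPairs-map∈ (r ∷ rs) f = All.tabulate (λ b∈ → f (here refl) (there b∈) (All.lookup r b∈)) ∷
                           AllPairs-map∈ rs (λ a∈ b∈ → f (there a∈) (there b∈))

nonempty : ∀ {A : Set} {xs : List A} → 1 ℕ.≤ length xs → ∃ (_∈ xs)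
nonempty {xs = x ∷ _} _ = x , here refl

length-without : ∀ {A : Set} (_≟_ : (a b : A) → Dec (a ≡ b)) {x} (xs : List A) → Unique xs → x ∈ xs →
                 suc (length (filter (¬? ∘ (_≟ x)) xs)) ≡ length xs
length-without _≟_ {x} (y ∷ xs) (y∉xs ∷ _) (here refl) with y ≟ y
... | no  y≢y = ⊥-elim (y≢y refl)
... | yes _   = cong (suc ∘ length) (List.filter-all (¬? ∘ (_≟ y)) (All.map (λ y≢z z≡y → y≢z (sym z≡y)) y∉xs))
length-without _≟_ {x} (y ∷ xs) (y∉xs ∷ !xs) (there x∈xs) with y ≟ x
... | yes refl = ⊥-elim (All.lookup y∉xs x∈xs refl)
... | no  _    = cong suc (length-without _≟_ xs !xs x∈xs)

length-positionsExcept : ∀ n {p₀} → p₀ ∈ positions n → suc (length (positionsExcept n p₀)) ≡ length (positions n)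
length-positionsExcept n p₀∈ = length-without _≟²_ (positions n) (positions-unique n) p₀∈

-- Linear algebra over ℚ

entry : Array → ℕ × ℕ → Bool
entry x (i , j) = x i j

coeff : Functional → ℕ × ℕ → ℚ
coeff c (i , j) = c i j

combination : {A : Set} → List ℚ → List A → (A → ℚ) → ℚ
combination ls ps f = sumℚ (zipWith (λ l p → l ℚ.* f p) ls ps)

module _ {A : Set} where

  combination-+ : ∀ ls (ps : List A) f g →
                  combination ls ps (λ p → f p ℚ.+ g p) ≡ combination ls ps f ℚ.+ combination ls ps g
  combination-+ []       ps       f g = refl
  combination-+ (l ∷ ls) []       f g = refl
  combination-+ (l ∷ ls) (p ∷ ps) f g =
    trans (cong₂ ℚ._+_ (ℚ.*-distribˡ-+ l (f p) (g p)) (combination-+ ls ps f g))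
          (solve 4 (λ a b c d → (a :+ b) :+ (c :+ d) := (a :+ c) :+ (b :+ d)) refl
            (l ℚ.* f p) (l ℚ.* g p) (combination ls ps f) (combination ls ps g))
    where open ℚ-Solver.+-*-Solver

  combination-*ˡ : ∀ ls (ps : List A) r f → combination ls ps (λ p → r ℚ.* f p) ≡ r ℚ.* combination ls ps f
  combination-*ˡ []       ps       r f = sym (ℚ.*-zeroʳ r)
  combination-*ˡ (l ∷ ls) []       r f = sym (ℚ.*-zeroʳ r)
  combination-*ˡ (l ∷ ls) (p ∷ ps) r f =
    trans (cong₂ ℚ._+_ (solve 3 (λ l r x → l :* (r :* x) := r :* (l :* x)) refl l r (f p)) (combination-*ˡ ls ps r f))
          (sym (ℚ.*-distribˡ-+ r (l ℚ.* f p) (combination ls ps f)))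
    where open ℚ-Solver.+-*-Solver

  combination-scale : ∀ ls (ps : List A) r f → combination (map (r ℚ.*_) ls) ps f ≡ r ℚ.* combination ls ps f
  combination-scale []       ps       r f = sym (ℚ.*-zeroʳ r)
  combination-scale (l ∷ ls) []       r f = sym (ℚ.*-zeroʳ r)
  combination-scale (l ∷ ls) (p ∷ ps) r f =
    trans (cong₂ ℚ._+_ (ℚ.*-assoc r l (f p)) (combination-scale ls ps r f))
          (sym (ℚ.*-distribˡ-+ r (l ℚ.* f p) (combination ls ps f)))

  combination-cong : ∀ ls (ps : List A) {f g} → All (λ p → f p ≡ g p) ps → combination ls ps f ≡ combination ls ps g
  combination-cong []       ps       _          = refl
  combination-cong (l ∷ ls) []       _          = refl
  combination-cong (l ∷ ls) (p ∷ ps) (fp≡gp ∷ e) = cong₂ ℚ._+_ (cong (l ℚ.*_) fp≡gp) (combination-cong ls ps e)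

  combination-const : ∀ ls (ps : List A) r → length ls ≡ length ps → combination ls ps (λ _ → r) ≡ r ℚ.* sumℚ ls
  combination-const []       []       r _   = sym (ℚ.*-zeroʳ r)
  combination-const (l ∷ ls) (p ∷ ps) r len =
    trans (cong₂ ℚ._+_ (ℚ.*-comm l r) (combination-const ls ps r (ℕ.suc-injective len)))
          (sym (ℚ.*-distribˡ-+ r l (sumℚ ls)))

  combination-zeroˡ : ∀ ls (ps : List A) {f} → All (_≡ 0ℚ) ls → combination ls ps f ≡ 0ℚ
  combination-zeroˡ []       ps       _          = refl
  combination-zeroˡ (l ∷ ls) []       _          = refl
  combination-zeroˡ (l ∷ ls) (p ∷ ps) {f} (refl ∷ z) =
    trans (cong₂ ℚ._+_ (ℚ.*-zeroˡ (f p)) (combination-zeroˡ ls ps z)) (ℚ.+-identityˡ 0ℚ)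

  combination-zeroʳ : ∀ ls (ps : List A) → combination ls ps (λ _ → 0ℚ) ≡ 0ℚ
  combination-zeroʳ []       ps       = refl
  combination-zeroʳ (l ∷ ls) []       = refl
  combination-zeroʳ (l ∷ ls) (p ∷ ps) = trans (cong₂ ℚ._+_ (ℚ.*-zeroʳ l) (combination-zeroʳ ls ps)) (ℚ.+-identityˡ 0ℚ)

  combination-∑ : ∀ {B : Set} ls (ps : List A) (qs : List B) (h : A → B → ℚ) →
                  combination ls ps (λ p → ∑ℚ qs (h p)) ≡ ∑ℚ qs (λ q → combination ls ps (λ p → h p q))
  combination-∑ []       ps       qs h = sym (ℚ-Sum.∑-zeros qs {λ _ → 0ℚ} (λ _ → refl))
  combination-∑ (l ∷ ls) []       qs h = sym (ℚ-Sum.∑-zeros qs {λ _ → 0ℚ} (λ _ → refl))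
  combination-∑ (l ∷ ls) (p ∷ ps) qs h =
    trans (cong₂ ℚ._+_ (sym (ℚ-Sum.∑-*ˡ qs l (h p))) (combination-∑ ls ps qs h))
          (sym (ℚ-Sum.∑-+ qs (λ q → l ℚ.* h p q) (λ q → combination ls ps (λ p → h p q))))

-- One step of Gaussian elimination: f₀ clears the value at p of every other functional.
module Elimination {A : Set} (p : A) (ps : List A) (f₀ : A → ℚ) where

  open ℚ-Solver.+-*-Solver

  eliminate : (A → ℚ) → A → ℚ
  eliminate f x = f₀ p ℚ.* f x ℚ.+ ℚ.- f p ℚ.* f₀ x

  extended : List ℚ → List ℚ
  extended μ = ℚ.- combination μ ps f₀ ∷ map (f₀ p ℚ.*_) μ

  extended-solves-f₀ : ∀ μ → combination (extended μ) (p ∷ ps) f₀ ≡ 0ℚ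
  extended-solves-f₀ μ = trans (cong (ℚ.- combination μ ps f₀ ℚ.* f₀ p ℚ.+_) (combination-scale μ ps (f₀ p) f₀))
                               (solve 2 (λ c a → :- c :* a :+ a :* c := con 0ℚ) refl (combination μ ps f₀) (f₀ p))

  extended-solves : ∀ μ {f} → combination μ ps (eliminate f) ≡ 0ℚ → combination (extended μ) (p ∷ ps) f ≡ 0ℚ
  extended-solves μ {f} μ-kills-f = begin
    ℚ.- C₀ ℚ.* f p ℚ.+ combination (map (a ℚ.*_) μ) ps f  ≡⟨ cong (ℚ.- C₀ ℚ.* f p ℚ.+_) (combination-scale μ ps a f) ⟩
    ℚ.- C₀ ℚ.* f p ℚ.+ a ℚ.* combination μ ps f           ≡⟨ solve 4 (λ c₀ fp a c → :- c₀ :* fp :+ a :* c := a :* c :+ :- fp :* c₀) refl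
                                                                      C₀ (f p) a (combination μ ps f) ⟩
    a ℚ.* combination μ ps f ℚ.+ ℚ.- f p ℚ.* C₀           ≡⟨ cong₂ ℚ._+_ (combination-*ˡ μ ps a f) (combination-*ˡ μ ps (ℚ.- f p) f₀) ⟨
    combination μ ps (λ x → a ℚ.* f x) ℚ.+ combination μ ps (λ x → ℚ.- f p ℚ.* f₀ x)
                                                           ≡⟨ combination-+ μ ps (λ x → a ℚ.* f x) (λ x → ℚ.- f p ℚ.* f₀ x) ⟨
    combination μ ps (eliminate f)                         ≡⟨ μ-kills-f ⟩
    0ℚ                                                     ∎
    where
    open ≡-Reasoning
    a = f₀ p
    C₀ = combination μ ps f₀

homogeneous-solution : {A : Set} (ps : List A) (fs : List (A → ℚ)) → length fs ℕ.< length ps →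
  Σ[ ls ∈ List ℚ ] (length ls ≡ length ps × Any (_≢ 0ℚ) ls × All (λ f → combination ls ps f ≡ 0ℚ) fs)
homogeneous-solution (p ∷ ps) fs (s≤s |fs|≤|ps|) with All.all? (λ f → f p ℚ.≟ 0ℚ) fs
... | yes fs[p]≡0 =
  1ℚ ∷ replicate (length ps) 0ℚ , cong suc (List.length-replicate (length ps)) , here (λ ()) , All.map (λ {f} → solves {f}) fs[p]≡0
  where
  solves : ∀ {f} → f p ≡ 0ℚ → combination (1ℚ ∷ replicate (length ps) 0ℚ) (p ∷ ps) f ≡ 0ℚ
  solves {f} f[p]≡0 = trans (cong₂ ℚ._+_ (cong (1ℚ ℚ.*_) f[p]≡0) (combination-zeroˡ _ ps {f} (All.replicate⁺ (length ps) refl)))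
                            (ℚ.+-identityˡ 0ℚ)
... | no ¬fs[p]≡0 =
  extended μ , cong suc (trans (List.length-map (f₀ p ℚ.*_) μ) |μ|≡|ps|) , there (Any.map⁺ (Any.map (*-≢0 f₀[p]≢0) μ≢0)) ,
  All.─⁻ f₀∈ (extended-solves-f₀ μ) (All.map (extended-solves μ) (All.map⁻ μ-solves))
  where
  f₀∈ : Any (λ f → f p ≢ 0ℚ) fs
  f₀∈ = All.¬All⇒Any¬ (λ f → f p ℚ.≟ 0ℚ) fs ¬fs[p]≡0
  f₀ = Any.lookup f₀∈
  f₀[p]≢0 = Any.lookup-result f₀∈
  open Elimination p ps f₀
  |others|<|ps| : length (map eliminate (fs Any.─ f₀∈)) ℕ.< length ps
  |others|<|ps| = ℕ.≤-trans (ℕ.≤-reflexive (trans (cong suc (List.length-map eliminate (fs Any.─ f₀∈)))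
                                                  (sym (List.length-removeAt′ fs (Any.index f₀∈)))))
                            |fs|≤|ps|
  μ-solution = homogeneous-solution ps (map eliminate (fs Any.─ f₀∈)) |others|<|ps|
  μ          = proj₁ μ-solution
  |μ|≡|ps|   = proj₁ (proj₂ μ-solution)
  μ≢0        = proj₁ (proj₂ (proj₂ μ-solution))
  μ-solves   = proj₂ (proj₂ (proj₂ μ-solution))

-- Affine independence

coordinate : ℕ × ℕ → Array → ℚ
coordinate q x = bℚ (entry x q)

AffineRelation : ℕ → List Array → List ℚ → Set
AffineRelation n ps ls = length ls ≡ length ps × sumℚ ls ≡ 0ℚ ×
                         (∀ {q} → q ∈ positions n → combination ls ps (coordinate q) ≡ 0ℚ)

affInd⇒trivial : ∀ n {ps ls} → AffInd n ps → AffineRelation n ps ls → All (_≡ 0ℚ) ls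
affInd⇒trivial n ind (|ls|≡|ps| , ∑ls≡0 , coords≡0) = ind _ |ls|≡|ps| ∑ls≡0 coords≡0

affInd⇒¬nontrivial : ∀ n {ps ls} → AffInd n ps → AffineRelation n ps ls → ¬ Any (_≢ 0ℚ) ls
affInd⇒¬nontrivial n ind rel = All.All¬⇒¬Any (All.map (λ l≡0 l≢0 → l≢0 l≡0) (affInd⇒trivial n ind rel))

combination-dot : ∀ n c ls ps →
  combination ls ps (dot n c) ≡ ∑ℚ (positions n) (λ q → coeff c q ℚ.* combination ls ps (coordinate q))
combination-dot n c ls ps = trans (combination-∑ ls ps (positions n) _)
  (ℚ-Sum.∑-cong (positions n) (λ {q} _ → combination-*ˡ ls ps (coeff c q) (coordinate q)))

relation-kills-dot : ∀ n c ls ps → (∀ {q} → q ∈ positions n → combination ls ps (coordinate q) ≡ 0ℚ) →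
                     combination ls ps (dot n c) ≡ 0ℚ
relation-kills-dot n c ls ps coords≡0 = trans (combination-dot n c ls ps)
  (ℚ-Sum.∑-zeros (positions n) (λ {q} q∈ → trans (cong (coeff c q ℚ.*_) (coords≡0 q∈)) (ℚ.*-zeroʳ (coeff c q))))

coordinate-relation : (qs : List (ℕ × ℕ)) (ps : List Array) → suc (length qs) ℕ.< length ps →
  Σ[ ls ∈ List ℚ ] (length ls ≡ length ps × Any (_≢ 0ℚ) ls × sumℚ ls ≡ 0ℚ ×
                    All (λ q → combination ls ps (coordinate q) ≡ 0ℚ) qs)
coordinate-relation qs ps |qs|+1<|ps|
  with homogeneous-solution ps ((λ _ → 1ℚ) ∷ map coordinate qs)
         (subst (λ k → suc k ℕ.< length ps) (sym (List.length-map coordinate qs)) |qs|+1<|ps|)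
... | ls , |ls|≡|ps| , ls≢0 , ∑ls≡0 ∷ coords≡0 =
  ls , |ls|≡|ps| , ls≢0 , trans (sym (trans (combination-const ls ps 1ℚ |ls|≡|ps|) (ℚ.*-identityˡ (sumℚ ls)))) ∑ls≡0 ,
  All.map⁻ coords≡0

affInd-length-≤ : ∀ n ps → AffInd n ps → length ps ℕ.≤ suc (length (positions n))
affInd-length-≤ n ps ind with suc (suc (length (positions n))) ℕ.≤? length ps
... | no  |ps|≯d+1 = ℕ.≤-pred (ℕ.≰⇒> |ps|≯d+1)
... | yes |ps|>d+1 with coordinate-relation (positions n) ps |ps|>d+1
...   | ls , |ls|≡|ps| , ls≢0 , ∑ls≡0 , coords≡0 =
  ⊥-elim (affInd⇒¬nontrivial n ind (|ls|≡|ps| , ∑ls≡0 , All.lookup coords≡0) ls≢0)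

module _ (n : ℕ) (a : Functional) (α : ℚ) {p₀ : ℕ × ℕ} (p₀∈ : p₀ ∈ positions n) (a[p₀]≢0 : coeff a p₀ ≢ 0ℚ) where

  -- Off p₀ the coordinates are killed directly; at p₀ the hyperplane equation forces it.
  hyperplane-relation : (ps : List Array) → All (λ p → dot n a p ≡ α) ps → length (positions n) ℕ.< length ps →
                        Σ[ ls ∈ List ℚ ] (AffineRelation n ps ls × Any (_≢ 0ℚ) ls)
  hyperplane-relation ps on-hyperplane d<|ps| with coordinate-relation (positionsExcept n p₀) ps
                                                      (ℕ.≤-trans (ℕ.≤-reflexive (cong suc (length-positionsExcept n p₀∈))) d<|ps|)
  ... | ls , |ls|≡|ps| , ls≢0 , ∑ls≡0 , coords≡0 = ls , (|ls|≡|ps| , ∑ls≡0 , coords) , ls≢0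
    where
    E : ℕ × ℕ → ℚ
    E q = combination ls ps (coordinate q)
    E[others]≡0 : ∀ {q} → q ∈ positions n → q ≢ p₀ → E q ≡ 0ℚ
    E[others]≡0 q∈ q≢p₀ = All.lookup coords≡0 (∈-positionsExcept⁺ {n} q∈ q≢p₀)
    a[p₀]E[p₀]≡0 : coeff a p₀ ℚ.* E p₀ ≡ 0ℚ
    a[p₀]E[p₀]≡0 = begin
      coeff a p₀ ℚ.* E p₀                                  ≡⟨ ℚ-Sum.∑-supported (positions n) p₀ _ (positions-unique n) p₀∈
                                                               (λ {q} q∈ q≢p₀ → trans (cong (coeff a q ℚ.*_) (E[others]≡0 q∈ q≢p₀)) (ℚ.*-zeroʳ (coeff a q))) ⟨
      ∑ℚ (positions n) (λ q → coeff a q ℚ.* E q)           ≡⟨ combination-dot n a ls ps ⟨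
      combination ls ps (dot n a)                          ≡⟨ combination-cong ls ps on-hyperplane ⟩
      combination ls ps (λ _ → α)                          ≡⟨ combination-const ls ps α |ls|≡|ps| ⟩
      α ℚ.* sumℚ ls                                        ≡⟨ cong (α ℚ.*_) ∑ls≡0 ⟩
      α ℚ.* 0ℚ                                             ≡⟨ ℚ.*-zeroʳ α ⟩
      0ℚ                                                   ∎
      where open ≡-Reasoning
    coords : ∀ {q} → q ∈ positions n → E q ≡ 0ℚ
    coords {q} q∈ with q ≟² p₀
    ... | yes refl  = x*y≡0⇒y≡0 (coeff a p₀) (E p₀) a[p₀]≢0 a[p₀]E[p₀]≡0
    ... | no  q≢p₀ = E[others]≡0 q∈ q≢p₀

  affInd-on-hyperplane-length-≤ : ∀ ps → All (λ p → dot n a p ≡ α) ps → AffInd n ps → length ps ℕ.≤ length (positions n)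
  affInd-on-hyperplane-length-≤ ps on-hyperplane ind with length (positions n) ℕ.<? length ps
  ... | no  |ps|≯d = ℕ.≮⇒≥ |ps|≯d
  ... | yes |ps|>d with hyperplane-relation ps on-hyperplane |ps|>d
  ...   | ls , rel , ls≢0 = ⊥-elim (affInd⇒¬nontrivial n ind rel ls≢0)

  hyperplane-spanned : (ps : List Array) → length ps ≡ length (positions n) → AffInd n ps → All (λ p → dot n a p ≡ α) ps →
                       (c : Functional) (β : ℚ) → All (λ p → dot n c p ≡ β) ps → ∀ x → dot n a x ≡ α → dot n c x ≡ β
  hyperplane-spanned ps |ps|≡d ind ps-on-a c β ps-on-c x x-on-a
    with hyperplane-relation (x ∷ ps) (x-on-a ∷ ps-on-a) (ℕ.≤-reflexive (cong suc (sym |ps|≡d)))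
  ... | l ∷ ls , (|ls|≡|ps| , l+∑ls≡0 , coords≡0) , nontrivial with l ℚ.≟ 0ℚ
  ...   | yes refl = ⊥-elim (affInd⇒¬nontrivial n ind tail-relation (tail-nontrivial nontrivial))
    where
    tail-relation : AffineRelation n ps ls
    tail-relation = ℕ.suc-injective |ls|≡|ps| , trans (sym (ℚ.+-identityˡ (sumℚ ls))) l+∑ls≡0 ,
                    λ {q} q∈ → trans (sym (trans (cong (ℚ._+ combination ls ps (coordinate q)) (ℚ.*-zeroˡ (coordinate q x)))
                                                (ℚ.+-identityˡ _)))
                                     (coords≡0 q∈)
    tail-nontrivial : Any (_≢ 0ℚ) (0ℚ ∷ ls) → Any (_≢ 0ℚ) ls
    tail-nontrivial (here 0≢0) = ⊥-elim (0≢0 refl)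
    tail-nontrivial (there ls≢0) = ls≢0
  ...   | no l≢0 = begin
    dot n c x                   ≡⟨ solve 2 (λ y b → y := (y :- b) :+ b) refl (dot n c x) β ⟩
    (dot n c x ℚ.- β) ℚ.+ β     ≡⟨ cong (ℚ._+ β) (x*y≡0⇒y≡0 l _ l≢0 l[cx-β]≡0) ⟩
    0ℚ ℚ.+ β                    ≡⟨ ℚ.+-identityˡ β ⟩
    β                           ∎
    where
    open ≡-Reasoning
    open ℚ-Solver.+-*-Solver
    ∑ls≡-l : sumℚ ls ≡ ℚ.- l
    ∑ls≡-l = trans (solve 2 (λ l s → s := (l :+ s) :- l) refl l (sumℚ ls))
                   (trans (cong (ℚ._- l) l+∑ls≡0) (ℚ.+-identityˡ (ℚ.- l)))
    l[cx-β]≡0 : l ℚ.* (dot n c x ℚ.- β) ≡ 0ℚ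
    l[cx-β]≡0 = begin
      l ℚ.* (dot n c x ℚ.- β)                          ≡⟨ solve 3 (λ l y b → l :* (y :- b) := l :* y :+ b :* (:- l)) refl l (dot n c x) β ⟩
      l ℚ.* dot n c x ℚ.+ β ℚ.* ℚ.- l                  ≡⟨ cong (λ s → l ℚ.* dot n c x ℚ.+ β ℚ.* s) ∑ls≡-l ⟨
      l ℚ.* dot n c x ℚ.+ β ℚ.* sumℚ ls                ≡⟨ cong (l ℚ.* dot n c x ℚ.+_) (combination-const ls ps β (ℕ.suc-injective |ls|≡|ps|)) ⟨
      l ℚ.* dot n c x ℚ.+ combination ls ps (λ _ → β)  ≡⟨ cong (l ℚ.* dot n c x ℚ.+_) (combination-cong ls ps ps-on-c) ⟨
      combination (l ∷ ls) (x ∷ ps) (dot n c)          ≡⟨ relation-kills-dot n c (l ∷ ls) (x ∷ ps) coords≡0 ⟩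
      0ℚ                                               ∎

affInd-[_] : ∀ {n} p → AffInd n [ p ]
affInd-[ p ] (l ∷ []) _ l+0≡0 _ = trans (sym (ℚ.+-identityʳ l)) l+0≡0 ∷ []

affInd-∷ : ∀ {n q p ps} → q ∈ positions n → entry p q ≡ true → All (λ x → entry x q ≡ false) ps →
           AffInd n ps → AffInd n (p ∷ ps)
affInd-∷ {n} {q} {p} {ps} q∈ p[q]≡1 ps[q]≡0 ind (l ∷ ls) |ls|≡|ps| l+∑ls≡0 coords≡0 =
  l≡0 ∷ affInd⇒trivial n ind (ℕ.suc-injective |ls|≡|ps| , ∑ls≡0 , tail-coords)
  where
  ps-kill-q : combination ls ps (coordinate q) ≡ 0ℚ
  ps-kill-q = trans (combination-cong ls ps (All.map (cong bℚ) ps[q]≡0)) (combination-zeroʳ ls ps)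
  l≡0 : l ≡ 0ℚ
  l≡0 = begin
    l                                               ≡⟨ ℚ.*-identityʳ l ⟨
    l ℚ.* 1ℚ                                        ≡⟨ ℚ.+-identityʳ _ ⟨
    l ℚ.* 1ℚ ℚ.+ 0ℚ                                 ≡⟨ cong₂ (λ b r → l ℚ.* bℚ b ℚ.+ r) p[q]≡1 ps-kill-q ⟨
    l ℚ.* coordinate q p ℚ.+ combination ls ps (coordinate q) ≡⟨ coords≡0 q∈ ⟩
    0ℚ                                              ∎
    where open ≡-Reasoning
  ∑ls≡0 : sumℚ ls ≡ 0ℚ
  ∑ls≡0 = trans (sym (ℚ.+-identityˡ (sumℚ ls))) (trans (cong (ℚ._+ sumℚ ls) (sym l≡0)) l+∑ls≡0)
  tail-coords : ∀ {q′} → q′ ∈ positions n → combination ls ps (coordinate q′) ≡ 0ℚ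
  tail-coords {q′} q′∈ = trans (sym (ℚ.+-identityˡ _))
    (trans (cong (ℚ._+ combination ls ps (coordinate q′)) (sym (trans (cong (ℚ._* coordinate q′ p) l≡0) (ℚ.*-zeroˡ (coordinate q′ p)))))
           (coords≡0 q′∈))

triangular-affInd : ∀ {A : Set} n (P : A → Array) (D : A → ℕ × ℕ) (base : Array) qs →
  All (λ q → D q ∈ positions n) qs → All (λ q → entry (P q) (D q) ≡ true) qs →
  AllPairs (λ q q′ → entry (P q′) (D q) ≡ false) qs → All (λ q → entry base (D q) ≡ false) qs →
  AffInd n (map P qs ++ [ base ])
triangular-affInd n P D base []       _              _             _                _ = affInd-[_] {n} base
triangular-affInd n P D base (q ∷ qs) (Dq∈ ∷ Ds∈) (Pq[Dq] ∷ P[D]) (later ∷ pairs) (base[Dq] ∷ base[D]) =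
  affInd-∷ {n} Dq∈ Pq[Dq] (All.++⁺ (All.map⁺ later) (base[Dq] ∷ []))
           (triangular-affInd n P D base qs Ds∈ P[D] pairs base[D])

indicator : List (ℕ × ℕ) → Array
indicator L i j = does ((i , j) ∈? L)

indicator-∈ : ∀ {L q} → q ∈ L → entry (indicator L) q ≡ true
indicator-∈ {L} {q} q∈L = dec-true (q ∈? L) q∈L

indicator-∉ : ∀ {L q} → q ∉ L → entry (indicator L) q ≡ false
indicator-∉ {L} {q} q∉L = dec-false (q ∈? L) q∉L

indicator-true⇒∈ : ∀ {L q} → entry (indicator L) q ≡ true → q ∈ L
indicator-true⇒∈ {L} {q} L[q]≡1 with q ∈? L
... | yes q∈L = q∈L
... | no  _   = ⊥-elim (case L[q]≡1 of λ ())

unit-∈ : ∀ q → entry (indicator [ q ]) q ≡ true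
unit-∈ q = indicator-∈ {[ q ]} (here refl)

unit-∉ : ∀ {q p} → p ≢ q → entry (indicator [ q ]) p ≡ false
unit-∉ {q} p≢q = indicator-∉ {[ q ]} λ { (here p≡q) → p≢q p≡q }

indicatorF : List (ℕ × ℕ) → Functional
indicatorF S i j = bℚ (indicator S i j)

∑-indicator : ∀ S P (f : ℕ × ℕ → ℚ) → Unique S → Unique P → All (_∈ P) S →
              ∑ℚ P (λ q → bℚ (entry (indicator S) q) ℚ.* f q) ≡ ∑ℚ S f
∑-indicator S P f !S !P S⊆P =
  trans (ℚ-Sum.∑-χ-∈-swap _≟²_ bℚ refl refl P S f !P !S)
        (ℚ-Sum.∑-cong S (λ {q} q∈S → trans (cong (λ b → bℚ b ℚ.* f q) (indicator-∈ (All.lookup S⊆P q∈S))) (ℚ.*-identityˡ (f q))))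

dot-indicatorF : ∀ n S x → Unique S → All (_∈ positions n) S → dot n (indicatorF S) x ≡ ∑ℚ S (λ q → coordinate q x)
dot-indicatorF n S x !S S⊆ = ∑-indicator S (positions n) (λ q → coordinate q x) !S (positions-unique n) S⊆

dot-neg : ∀ n c x → dot n (λ i j → ℚ.- c i j) x ≡ ℚ.- dot n c x
dot-neg n c x = trans (ℚ-Sum.∑-cong (positions n) (λ {q} _ → sym (ℚ.neg-distribˡ-* (coeff c q) (coordinate q x))))
                      (∑ℚ-neg (positions n) (λ q → coeff c q ℚ.* coordinate q x))

dot-sub : ∀ n c d x → dot n (λ i j → c i j ℚ.- d i j) x ≡ dot n c x ℚ.- dot n d x
dot-sub n c d x = trans (ℚ-Sum.∑-cong (positions n) (λ {q} _ → distrib (coeff c q) (coeff d q) (coordinate q x)))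
                        (trans (ℚ-Sum.∑-+ (positions n) (λ q → coeff c q ℚ.* coordinate q x) (λ q → ℚ.- (coeff d q ℚ.* coordinate q x)))
                               (cong (dot n c x ℚ.+_) (∑ℚ-neg (positions n) (λ q → coeff d q ℚ.* coordinate q x))))
  where
  distrib : ∀ a b y → (a ℚ.- b) ℚ.* y ≡ a ℚ.* y ℚ.+ ℚ.- (b ℚ.* y)
  distrib = solve 3 (λ a b y → (a :- b) :* y := a :* y :+ :- (b :* y)) refl
    where open ℚ-Solver.+-*-Solver

segment : ℕ → ℕ → ℕ → List (ℕ × ℕ)
segment c lo hi = map (_, c) (range lo hi)

columnSumOf : (ℕ × ℕ → ℕ) → ℕ → ℕ → ℕ → ℕ
columnSumOf Y c lo hi = ∑ℕ (range lo hi) (λ k → Y (k , c))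

columnSum : Array → ℕ → ℕ → ℕ → ℕ
columnSum x = columnSumOf (bℕ ∘ entry x)

module _ {c lo hi : ℕ} where

  ∈-segment⁺ : ∀ {k} → lo ℕ.≤ k → k ℕ.≤ hi → (k , c) ∈ segment c lo hi
  ∈-segment⁺ lo≤k k≤hi = ∈-map⁺ (_, c) (∈-range⁺ lo≤k k≤hi)

  ∈-segment⁻ : ∀ {k c′} → (k , c′) ∈ segment c lo hi → c′ ≡ c × lo ℕ.≤ k × k ℕ.≤ hi
  ∈-segment⁻ k∈ with ∈-map⁻ (_, c) k∈
  ... | k , k∈range , refl = refl , ∈-range⁻ k∈range

  segment-unique : Unique (segment c lo hi)
  segment-unique = Unique.map⁺ (cong proj₁) (range-unique lo hi)

  segment⊆positions : ∀ {n} → 1 ℕ.≤ c → c ℕ.≤ lo → hi ℕ.≤ n ∸ 1 → All (_∈ positions n) (segment c lo hi)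
  segment⊆positions {n} 1≤c c≤lo hi≤ = All.map⁺ (All.tabulate (λ k∈ →
    ∈-positions⁺ {n} 1≤c (ℕ.≤-trans c≤lo (proj₁ (∈-range⁻ k∈))) (ℕ.≤-trans (proj₂ (∈-range⁻ k∈)) hi≤)))

  in-segment : ∀ {k} → lo ℕ.≤ k → k ℕ.≤ hi → bℕ (entry (indicator (segment c lo hi)) (k , c)) ≡ 1
  in-segment lo≤k k≤hi = cong bℕ (indicator-∈ (∈-segment⁺ lo≤k k≤hi))

  off-column : ∀ {k c′} → c′ ≢ c → bℕ (entry (indicator (segment c lo hi)) (k , c′)) ≡ 0
  off-column c′≢c = cong bℕ (indicator-∉ (c′≢c ∘ proj₁ ∘ ∈-segment⁻))

  below-segment : ∀ {k c′} → hi ℕ.< k → bℕ (entry (indicator (segment c lo hi)) (k , c′)) ≡ 0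
  below-segment hi<k = cong bℕ (indicator-∉ (ℕ.<⇒≱ hi<k ∘ proj₂ ∘ proj₂ ∘ ∈-segment⁻))

  columnSum-indicator : ∀ L → Unique L →
    columnSum (indicator L) c lo hi ≡ ∑ℕ L (λ q → bℕ (entry (indicator (segment c lo hi)) q))
  columnSum-indicator L !L = begin
    columnSum (indicator L) c lo hi                                   ≡⟨ ℕ-Sum.∑-map (_, c) (range lo hi) (λ q → bℕ (entry (indicator L) q)) ⟨
    ∑ℕ (segment c lo hi) (λ q → bℕ (entry (indicator L) q))           ≡⟨ ℕ-Sum.∑-cong (segment c lo hi) (λ _ → ℕ.*-identityʳ _) ⟨
    ∑ℕ (segment c lo hi) (λ q → bℕ (entry (indicator L) q) * 1)       ≡⟨ ℕ-Sum.∑-χ-∈-swap _≟²_ bℕ refl refl (segment c lo hi) L (λ _ → 1) segment-unique !L ⟩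
    ∑ℕ L (λ q → bℕ (entry (indicator (segment c lo hi)) q) * 1)       ≡⟨ ℕ-Sum.∑-cong L (λ _ → ℕ.*-identityʳ _) ⟩
    ∑ℕ L (λ q → bℕ (entry (indicator (segment c lo hi)) q))           ∎
    where open ≡-Reasoning

  dot-segment : ∀ n x → 1 ℕ.≤ c → c ℕ.≤ lo → hi ℕ.≤ n ∸ 1 →
                dot n (indicatorF (segment c lo hi)) x ≡ toℚ (columnSum x c lo hi)
  dot-segment n x 1≤c c≤lo hi≤ = begin
    dot n (indicatorF (segment c lo hi)) x                ≡⟨ dot-indicatorF n (segment c lo hi) x segment-unique (segment⊆positions {n} 1≤c c≤lo hi≤) ⟩
    ∑ℚ (segment c lo hi) (λ q → coordinate q x)           ≡⟨ ℚ-Sum.∑-map (_, c) (range lo hi) (λ q → coordinate q x) ⟩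
    ∑ℚ (range lo hi) (λ k → bℚ (x k c))                   ≡⟨ ℚ-Sum.∑-cong (range lo hi) (λ {k} _ → bℚ≡toℚ∘bℕ (x k c)) ⟩
    ∑ℚ (range lo hi) (λ k → toℚ (bℕ (x k c)))             ≡⟨ toℚ-∑ (range lo hi) (λ k → bℕ (x k c)) ⟨
    toℚ (columnSum x c lo hi)                             ∎
    where open ≡-Reasoning

DistinctColumns : List (ℕ × ℕ) → Set
DistinctColumns = AllPairs (λ p q → proj₂ p ≢ proj₂ q)

∑-segment-≤1 : ∀ {c lo hi} L → DistinctColumns L → ∑ℕ L (λ q → bℕ (entry (indicator (segment c lo hi)) q)) ℕ.≤ 1
∑-segment-≤1             []              _ = z≤n
∑-segment-≤1 {c} {lo} {hi} ((k , c′) ∷ L) (c′∉L ∷ distinct) with c′ ℕ.≟ c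
... | yes refl = ℕ.≤-trans (ℕ.≤-reflexive (cong (bℕ (entry (indicator (segment c lo hi)) (k , c)) +_)
                   (ℕ-Sum.∑-zeros L (λ q∈L → off-column {c} {lo} {hi} (λ col≡c → All.lookup c′∉L q∈L (sym col≡c))))))
                   (ℕ.≤-trans (ℕ.≤-reflexive (ℕ.+-identityʳ _)) (bℕ≤1 (entry (indicator (segment c lo hi)) (k , c))))
... | no  c′≢c = ℕ.≤-trans (ℕ.≤-reflexive (cong (_+ _) (off-column {c} {lo} {hi} {k} c′≢c))) (∑-segment-≤1 {c} {lo} {hi} L distinct)

sparse-tss : ∀ n L → Unique L → DistinctColumns L → IsTSSCPP n (indicator L)
sparse-tss n L !L distinct i j _ _ _ =
  ℕ.≤-trans (ℕ.≤-trans (ℕ.≤-reflexive (columnSum-indicator {j} {j} {i} L !L)) (∑-segment-≤1 {j} {j} {i} L distinct)) (ℕ.m≤m+n 1 _)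

pair-unique : ∀ {c r₁ r₂ m : ℕ} → r₁ ≢ r₂ → Unique ((r₁ , c) ∷ (r₂ , c) ∷ (m , suc c) ∷ [])
pair-unique {c} r₁≢r₂ = ((r₁≢r₂ ∘ cong proj₁) ∷ (c≢1+c ∘ cong proj₂) ∷ []) ∷ ((c≢1+c ∘ cong proj₂) ∷ []) ∷ [] ∷ []
  where
  c≢1+c : c ≢ suc c
  c≢1+c = ℕ.<⇒≢ (ℕ.n<1+n c)

-- Two entries in column c are compensated by an entry of column c + 1 no lower than both of them.
pair-tss : ∀ n {c r₁ r₂ m} → r₁ ≢ r₂ → c ℕ.< m → m ℕ.≤ r₁ ℕ.⊔ r₂ →
           IsTSSCPP n (indicator ((r₁ , c) ∷ (r₂ , c) ∷ (m , suc c) ∷ []))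
pair-tss n {c} {r₁} {r₂} {m} r₁≢r₂ c<m m≤r₁⊔r₂ i j _ _ _ = begin
  columnSum (indicator L) j j i                                   ≡⟨ columnSum-indicator {j} {j} {i} L !L ⟩
  S j (r₁ , c) + (S j (r₂ , c) + (S j (m , suc c) + 0))            ≤⟨ bound (j ℕ.≟ c) ⟩
  1 + (S (suc j) (r₁ , c) + (S (suc j) (r₂ , c) + (S (suc j) (m , suc c) + 0)))
                                                                   ≡⟨ cong suc (columnSum-indicator {suc j} {suc j} {i} L !L) ⟨
  1 + columnSum (indicator L) (suc j) (suc j) i                   ∎
  where
  open ℕ.≤-Reasoning
  L = (r₁ , c) ∷ (r₂ , c) ∷ (m , suc c) ∷ []
  c≢1+c : c ≢ suc c
  c≢1+c = ℕ.<⇒≢ (ℕ.n<1+n c)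
  !L : Unique L
  !L = pair-unique {c} {r₁} {r₂} {m} r₁≢r₂
  S : ℕ → ℕ × ℕ → ℕ
  S col q = bℕ (entry (indicator (segment col col i)) q)
  S≤1 : ∀ col q → S col q ℕ.≤ 1
  S≤1 col q = bℕ≤1 (entry (indicator (segment col col i)) q)
  third≤ : ∀ a b d → d ℕ.≤ a + (b + (d + 0))
  third≤ a b d = ℕ.≤-trans (ℕ.m≤m+n d 0) (ℕ.≤-trans (ℕ.m≤n+m (d + 0) b) (ℕ.m≤n+m (b + (d + 0)) a))
  one-missing : ∀ a b d → a ≡ 0 ⊎ b ≡ 0 → a ℕ.≤ 1 → b ℕ.≤ 1 → d ≡ 0 → a + (b + (d + 0)) ℕ.≤ 1
  one-missing a b .0 (inj₁ refl) _ b≤1 refl = ℕ.≤-trans (ℕ.≤-reflexive (ℕ.+-identityʳ b)) b≤1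
  one-missing a b .0 (inj₂ refl) a≤1 _ refl = ℕ.≤-trans (ℕ.≤-reflexive (ℕ.+-identityʳ a)) a≤1
  bound : Dec (j ≡ c) → S j (r₁ , c) + (S j (r₂ , c) + (S j (m , suc c) + 0)) ℕ.≤
                        1 + (S (suc j) (r₁ , c) + (S (suc j) (r₂ , c) + (S (suc j) (m , suc c) + 0)))
  bound (no j≢c) = ℕ.≤-trans (begin
    S j (r₁ , c) + (S j (r₂ , c) + (S j (m , suc c) + 0))   ≡⟨ cong₂ (λ a b → a + (b + (S j (m , suc c) + 0)))
                                                                      (off-column {j} {j} {i} (j≢c ∘ sym)) (off-column {j} {j} {i} (j≢c ∘ sym)) ⟩
    S j (m , suc c) + 0                                      ≤⟨ ℕ.≤-trans (ℕ.≤-reflexive (ℕ.+-identityʳ _)) (S≤1 j (m , suc c)) ⟩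
    1                                                        ∎) (ℕ.m≤m+n 1 _)
  bound (yes refl) with r₁ ℕ.≤? i | r₂ ℕ.≤? i
  ... | yes r₁≤i | yes r₂≤i = begin
    S c (r₁ , c) + (S c (r₂ , c) + (S c (m , suc c) + 0))   ≡⟨ cong (λ z → S c (r₁ , c) + (S c (r₂ , c) + (z + 0)))
                                                                     (off-column {c} {c} {i} {m} (c≢1+c ∘ sym)) ⟩
    S c (r₁ , c) + (S c (r₂ , c) + 0)                        ≤⟨ ℕ.+-mono-≤ (S≤1 c (r₁ , c)) (ℕ.+-monoˡ-≤ 0 (S≤1 c (r₂ , c))) ⟩
    1 + 1                                                    ≡⟨ cong suc (in-segment {suc c} {suc c} {i} c<m (ℕ.≤-trans m≤r₁⊔r₂ (ℕ.⊔-lub r₁≤i r₂≤i))) ⟨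
    1 + S (suc c) (m , suc c)                                ≤⟨ ℕ.+-monoʳ-≤ 1 (third≤ (S (suc c) (r₁ , c)) (S (suc c) (r₂ , c)) (S (suc c) (m , suc c))) ⟩
    1 + (S (suc c) (r₁ , c) + (S (suc c) (r₂ , c) + (S (suc c) (m , suc c) + 0))) ∎
  ... | no r₁≰i | _        = ℕ.≤-trans (one-missing _ _ _ (inj₁ (below-segment {c} {c} {i} (ℕ.≰⇒> r₁≰i))) (S≤1 c _) (S≤1 c _)
                                         (off-column {c} {c} {i} {m} (c≢1+c ∘ sym))) (ℕ.m≤m+n 1 _)
  ... | _        | no r₂≰i = ℕ.≤-trans (one-missing _ _ _ (inj₂ (below-segment {c} {c} {i} (ℕ.≰⇒> r₂≰i))) (S≤1 c _) (S≤1 c _)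
                                         (off-column {c} {c} {i} {m} (c≢1+c ∘ sym))) (ℕ.m≤m+n 1 _)

-- Full dimension and a criterion for facets

length-family : ∀ {A : Set} (P : A → Array) qs b → length (map P qs ++ [ b ]) ≡ suc (length qs)
length-family P qs b = trans (List.length-++ (map P qs)) (trans (cong (_+ 1) (List.length-map P qs)) (ℕ.+-comm _ 1))

unitPoints : ℕ → List Array
unitPoints n = map (indicator ∘ [_]) (positions n) ++ [ indicator [] ]

unit-tss : ∀ n q → IsTSSCPP n (indicator [ q ])
unit-tss n q = sparse-tss n [ q ] ([] ∷ []) ([] ∷ [])

zero-tss : ∀ n → IsTSSCPP n (indicator [])
zero-tss n = sparse-tss n [] [] []

unitPoints-tss : ∀ n → All (IsTSSCPP n) (unitPoints n)
unitPoints-tss n = All.++⁺ (All.map⁺ (All.tabulate (λ {q} _ → unit-tss n q))) (zero-tss n ∷ [])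

unitPoints-affInd : ∀ n → AffInd n (unitPoints n)
unitPoints-affInd n = triangular-affInd n (indicator ∘ [_]) (λ q → q) (indicator []) (positions n)
  (All.tabulate (λ q∈ → q∈)) (All.tabulate (λ {q} _ → unit-∈ q))
  (AllPairs.map (λ {q} {q′} q≢q′ → unit-∉ {q′} {q} q≢q′) (positions-unique n)) (All.tabulate (λ _ → refl))

polytope-rank : ∀ n → AffRank n (IsTSSCPP n) (suc (length (positions n)))
polytope-rank n = (unitPoints n , unitPoints-tss n , length-family (indicator ∘ [_]) (positions n) (indicator []) , unitPoints-affInd n) ,
                  (λ ps _ ind → affInd-length-≤ n ps ind)

record TriangularFamily (n : ℕ) (h : Functional × ℚ) (p₀ : ℕ × ℕ) : Set where
  field
    point       : ℕ × ℕ → Array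
    designated  : ℕ × ℕ → ℕ × ℕ
    base        : Array
    base-on     : OnFace n h base
    point-on    : ∀ {q} → q ∈ positionsExcept n p₀ → OnFace n h (point q)
    designated∈ : ∀ {q} → q ∈ positionsExcept n p₀ → designated q ∈ positions n
    point-at    : ∀ {q} → q ∈ positionsExcept n p₀ → entry (point q) (designated q) ≡ true
    later-off   : ∀ {q q′} → q ∈ positionsExcept n p₀ → q′ ∈ positionsExcept n p₀ → q <ₗₑₓ q′ →
                  entry (point q′) (designated q) ≡ false
    base-off    : ∀ {q} → q ∈ positionsExcept n p₀ → entry base (designated q) ≡ false

triangular-facet : ∀ n {h p₀} → Valid n h → p₀ ∈ positions n → coeff (proj₁ h) p₀ ≢ 0ℚ →
                   TriangularFamily n h p₀ → DefinesFacet n h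
triangular-facet n {a , α} {p₀} valid p₀∈ a[p₀]≢0 T =
  valid , length (positions n) , ℕ.≤-trans (s≤s z≤n) (ℕ.≤-reflexive (length-positionsExcept n p₀∈)) ,
  ((family , family-on , family-length , family-affInd) ,
   λ ps ps-on ind → affInd-on-hyperplane-length-≤ n a α p₀∈ a[p₀]≢0 ps (All.map proj₂ ps-on) ind) ,
  polytope-rank n
  where
  open TriangularFamily T
  E = positionsExcept n p₀
  family = map point E ++ [ base ]
  family-on : All (OnFace n (a , α)) family
  family-on = All.++⁺ (All.map⁺ (All.tabulate point-on)) (base-on ∷ [])
  family-length : length family ≡ length (positions n)
  family-length = trans (length-family point E base) (length-positionsExcept n p₀∈)
  family-affInd : AffInd n family
  family-affInd = triangular-affInd n point designated base E (All.tabulate designated∈) (All.tabulate point-at)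
    (AllPairs-map∈ (positionsExcept-sorted {n} {p₀}) later-off)
    (All.tabulate base-off)

-- The three families of facets

dot-unit : ∀ n {q} x → q ∈ positions n → dot n (indicatorF [ q ]) x ≡ coordinate q x
dot-unit n {q} x q∈ = trans (dot-indicatorF n [ q ] x ([] ∷ []) (q∈ ∷ [])) (ℚ.+-identityʳ (coordinate q x))

lowerFacet : ℕ × ℕ → Functional × ℚ
lowerFacet q = (λ i j → ℚ.- indicatorF [ q ] i j) , 0ℚ

upperFacet : ℕ × ℕ → Functional × ℚ
upperFacet q = indicatorF [ q ] , 1ℚ

lowerFacet-coeff : ∀ q → coeff (proj₁ (lowerFacet q)) q ≢ 0ℚ
lowerFacet-coeff q -1≡0 = ℚ.1≢0 (ℚ.neg-injective (trans (cong (ℚ.-_ ∘ bℚ) (sym (unit-∈ q))) -1≡0))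

upperFacet-coeff : ∀ q → coeff (proj₁ (upperFacet q)) q ≢ 0ℚ
upperFacet-coeff q 1≡0 = ℚ.1≢0 (trans (cong bℚ (sym (unit-∈ q))) 1≡0)

dot-lowerFacet : ∀ n {q} x → q ∈ positions n → dot n (proj₁ (lowerFacet q)) x ≡ ℚ.- coordinate q x
dot-lowerFacet n x q∈ = trans (dot-neg n (indicatorF [ _ ]) x) (cong ℚ.-_ (dot-unit n x q∈))

lowerFacet-facet : ∀ n {q} → q ∈ positions n → DefinesFacet n (lowerFacet q)
lowerFacet-facet n {q} q∈ = triangular-facet n {lowerFacet q} valid q∈
  (lowerFacet-coeff q) (record
  { point       = indicator ∘ [_]
  ; designated  = λ q′ → q′
  ; base        = indicator []
  ; base-on     = zero-tss n , dot-lowerFacet n (indicator []) q∈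
  ; point-on    = λ {q′} q′∈ → unit-tss n q′ ,
                  trans (dot-lowerFacet n (indicator [ q′ ]) q∈) (cong (ℚ.-_ ∘ bℚ) (unit-∉ {q′} {q} (proj₂ (∈-positionsExcept⁻ {n} q′∈) ∘ sym)))
  ; designated∈ = proj₁ ∘ ∈-positionsExcept⁻ {n}
  ; point-at    = λ {q′} _ → unit-∈ q′
  ; later-off   = λ {q₁} {q₂} _ _ q₁<q₂ → unit-∉ {q₂} {q₁} (<ₗₑₓ⇒≢ q₁<q₂)
  ; base-off    = λ _ → refl
  })
  where
  valid : Valid n (lowerFacet q)
  valid x _ = ℚ.≤-trans (ℚ.≤-reflexive (dot-lowerFacet n x q∈)) (ℚ.neg-antimono-≤ (bℚ-nonNegative (entry x q)))

<ₗₑₓ-asym : ∀ {p q} → p <ₗₑₓ q → ¬ q <ₗₑₓ p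
<ₗₑₓ-asym (inj₁ i<i′)        (inj₁ i′<i)        = ℕ.<-asym i<i′ i′<i
<ₗₑₓ-asym (inj₁ i<i′)        (inj₂ (refl , _))  = ℕ.<-irrefl refl i<i′
<ₗₑₓ-asym (inj₂ (refl , _))  (inj₁ i′<i)        = ℕ.<-irrefl refl i′<i
<ₗₑₓ-asym (inj₂ (_ , j<j′))  (inj₂ (_ , j′<j))  = ℕ.<-asym j<j′ j′<j

dot-upperFacet : ∀ n {q} x → q ∈ positions n → dot n (proj₁ (upperFacet q)) x ≡ coordinate q x
dot-upperFacet = dot-unit

columnPartner : ∀ {a b k c} → Dec (c ≡ b) → List (ℕ × ℕ)
columnPartner {a} {b} {k} (yes _) = [ (a ℕ.⊔ k , suc b) ]
columnPartner             (no  _) = []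

-- A second entry in the column of (a , b) needs a partner in the next column.
upperSupport : ℕ × ℕ → ℕ × ℕ → List (ℕ × ℕ)
upperSupport (a , b) (k , c) = (a , b) ∷ (k , c) ∷ columnPartner {a} {b} {k} (c ℕ.≟ b)

module _ {a b k c : ℕ} where

  upperSupport-tss : ∀ n → b ℕ.≤ a → c ℕ.≤ k → (k , c) ≢ (a , b) → (c≟b : Dec (c ≡ b)) →
                     IsTSSCPP n (indicator ((a , b) ∷ (k , c) ∷ columnPartner {a} {b} {k} c≟b))
  upperSupport-tss n b≤a b≤k q′≢q (yes refl) = pair-tss n a≢k b<a⊔k ℕ.≤-refl
    where
    a≢k : a ≢ k
    a≢k a≡k = q′≢q (cong (_, b) (sym a≡k))
    b<a⊔k : b ℕ.< a ℕ.⊔ k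
    b<a⊔k with ℕ.<-cmp a k
    ... | tri< a<k _ _ = ℕ.<-≤-trans (ℕ.≤-<-trans b≤a a<k) (ℕ.m≤n⊔m a k)
    ... | tri≈ _ a≡k _ = ⊥-elim (a≢k a≡k)
    ... | tri> _ _ k<a = ℕ.<-≤-trans (ℕ.≤-<-trans b≤k k<a) (ℕ.m≤m⊔n a k)
  upperSupport-tss n _   _   q′≢q (no  c≢b) =
    sparse-tss n ((a , b) ∷ (k , c) ∷ []) (((q′≢q ∘ sym) ∷ []) ∷ [] ∷ []) (((c≢b ∘ sym) ∷ []) ∷ [] ∷ [])

  upperSupport-order : ∀ {y} (c≟b : Dec (c ≡ b)) → y ∈ (a , b) ∷ (k , c) ∷ columnPartner {a} {b} {k} c≟b →
                       y ≡ (a , b) ⊎ y ≡ (k , c) ⊎ (k , c) <ₗₑₓ y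
  upperSupport-order _          (here y≡q)          = inj₁ y≡q
  upperSupport-order _          (there (here y≡q′)) = inj₂ (inj₁ y≡q′)
  upperSupport-order (yes refl) (there (there (here refl))) with ℕ.m≤n⇒m<n∨m≡n (ℕ.m≤n⊔m a k)
  ... | inj₁ k<a⊔k = inj₂ (inj₂ (inj₁ k<a⊔k))
  ... | inj₂ k≡a⊔k = inj₂ (inj₂ (inj₂ (k≡a⊔k , ℕ.n<1+n b)))

upperFacet-facet : ∀ n {q} → q ∈ positions n → DefinesFacet n (upperFacet q)
upperFacet-facet n {a , b} q∈ = triangular-facet n {upperFacet (a , b)} valid q∈ (upperFacet-coeff (a , b)) (record
  { point       = indicator ∘ upperSupport q
  ; designated  = λ q′ → q′
  ; base        = indicator [ q ]
  ; base-on     = unit-tss n q , trans (dot-upperFacet n (indicator [ q ]) q∈) (cong bℚ (unit-∈ q))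
  ; point-on    = λ { {k , c} q′∈ → point-tss q′∈ (c ℕ.≟ b) ,
                      trans (dot-upperFacet n (indicator (upperSupport q (k , c))) q∈) (cong bℚ (indicator-∈ {upperSupport q (k , c)} (here refl))) }
  ; designated∈ = proj₁ ∘ ∈-positionsExcept⁻ {n}
  ; point-at    = λ {q′} _ → indicator-∈ {upperSupport q q′} (there (here refl))
  ; later-off   = λ { {q₁} {k , c} q₁∈ _ q₁<q₂ → indicator-∉ {upperSupport q (k , c)} (not-in-support q₁∈ q₁<q₂ (c ℕ.≟ b)) }
  ; base-off    = λ {q′} q′∈ → unit-∉ {q} {q′} (proj₂ (∈-positionsExcept⁻ {n} q′∈))
  })
  where
  q = (a , b)
  valid : Valid n (upperFacet q)
  valid x _ = ℚ.≤-trans (ℚ.≤-reflexive (dot-upperFacet n x q∈)) (bℚ≤1 (entry x q))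
  point-tss : ∀ {k c} → (k , c) ∈ positionsExcept n q → (c≟b : Dec (c ≡ b)) →
              IsTSSCPP n (indicator ((a , b) ∷ (k , c) ∷ columnPartner {a} {b} {k} c≟b))
  point-tss q′∈ = upperSupport-tss n (proj₁ (proj₂ (∈-positions⁻ {n} q∈))) (proj₁ (proj₂ (∈-positions⁻ {n} (proj₁ (∈-positionsExcept⁻ {n} q′∈)))))
                                     (proj₂ (∈-positionsExcept⁻ {n} q′∈))
  not-in-support : ∀ {q₁ k c} → q₁ ∈ positionsExcept n q → q₁ <ₗₑₓ (k , c) → (c≟b : Dec (c ≡ b)) →
                   q₁ ∉ (a , b) ∷ (k , c) ∷ columnPartner {a} {b} {k} c≟b
  not-in-support q₁∈ q₁<q₂ c≟b q₁∈support with upperSupport-order c≟b q₁∈support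
  ... | inj₁ q₁≡q          = proj₂ (∈-positionsExcept⁻ {n} q₁∈) q₁≡q
  ... | inj₂ (inj₁ q₁≡q₂)  = <ₗₑₓ⇒≢ q₁<q₂ q₁≡q₂
  ... | inj₂ (inj₂ q₂<q₁)  = <ₗₑₓ-asym q₁<q₂ q₂<q₁

inequalityFacet : ℕ × ℕ → Functional × ℚ
inequalityFacet (i , j) = (λ a b → indicatorF (segment j j i) a b ℚ.- indicatorF (segment (suc j) (suc j) i) a b) , 1ℚ

dot-inequalityFacet : ∀ n {i j} x → 1 ℕ.≤ j → i ℕ.≤ n ∸ 1 →
  dot n (proj₁ (inequalityFacet (i , j))) x ≡ toℚ (columnSum x j j i) ℚ.- toℚ (columnSum x (suc j) (suc j) i)
dot-inequalityFacet n {i} {j} x 1≤j i≤ =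
  trans (dot-sub n (indicatorF (segment j j i)) (indicatorF (segment (suc j) (suc j) i)) x)
        (cong₂ ℚ._-_ (dot-segment {j} {j} {i} n x 1≤j ℕ.≤-refl i≤) (dot-segment {suc j} {suc j} {i} n x (s≤s z≤n) ℕ.≤-refl i≤))

inequalityFacet-valid : ∀ n {i j} → 1 ℕ.≤ j → j ℕ.< i → i ℕ.≤ n ∸ 1 → Valid n (inequalityFacet (i , j))
inequalityFacet-valid n {i} {j} 1≤j j<i i≤ x x-tss = begin
  dot n (proj₁ (inequalityFacet (i , j))) x    ≡⟨ dot-inequalityFacet n x 1≤j i≤ ⟩
  toℚ a ℚ.- toℚ b                              ≤⟨ ℚ.+-monoˡ-≤ (ℚ.- toℚ b) (toℚ-mono-≤ (x-tss i j 1≤j j<i i≤)) ⟩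
  toℚ (suc b) ℚ.- toℚ b                        ≡⟨ toℚ-suc-diff b ⟩
  1ℚ                                           ∎
  where
  open ℚ.≤-Reasoning
  a = columnSum x j j i
  b = columnSum x (suc j) (suc j) i

module InequalityFamily (n i j : ℕ) (1≤j : 1 ℕ.≤ j) (j<i : j ℕ.< i) (i≤ : i ℕ.≤ n ∸ 1) where

  j′ : ℕ
  j′ = suc j

  b₀ : ℕ × ℕ
  b₀ = (j , j)

  j≢j′ : j ≢ j′
  j≢j′ = ℕ.<⇒≢ (ℕ.n<1+n j)

  -- Rows up to i lie inside the inequality, rows below i outside it.
  data Kind : ℕ × ℕ → Set where
    inside-j   : ∀ {k} → k ℕ.≤ i → Kind (k , j)
    outside-j  : ∀ {k} → i ℕ.< k → Kind (k , j)
    inside-j′  : ∀ {k} → k ℕ.≤ i → Kind (k , j′)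
    outside-j′ : ∀ {k} → i ℕ.< k → Kind (k , j′)
    other      : ∀ {k c} → c ≢ j → c ≢ j′ → Kind (k , c)

  kind : ∀ q → Kind q
  kind (k , c) with c ℕ.≟ j | c ℕ.≟ j′ | k ℕ.≤? i
  ... | yes refl | _        | yes k≤i = inside-j k≤i
  ... | yes refl | _        | no  k≰i = outside-j (ℕ.≰⇒> k≰i)
  ... | no  _    | yes refl | yes k≤i = inside-j′ k≤i
  ... | no  _    | yes refl | no  k≰i = outside-j′ (ℕ.≰⇒> k≰i)
  ... | no  c≢j  | no  c≢j′ | _       = other c≢j c≢j′

  -- Inside the inequality the designated coordinates of columns j and j′ are exchanged.
  swapOf : ∀ {q} → Kind q → ℕ × ℕ
  swapOf (inside-j   {k} _)   = (k , j′)
  swapOf (outside-j  {k} _)   = (k , j)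
  swapOf (inside-j′  {k} _)   = (k , j)
  swapOf (outside-j′ {k} _)   = (k , j′)
  swapOf (other {k} {c} _ _)  = (k , c)

  supportOf : ∀ {q} → Kind q → List (ℕ × ℕ)
  supportOf (inside-j   {k} _)  = b₀ ∷ (k , j) ∷ (k , j′) ∷ []
  supportOf (outside-j  {k} _)  = b₀ ∷ (k , j) ∷ (k , j′) ∷ []
  supportOf (inside-j′  {k} _)  = [ (k , j) ]
  supportOf (outside-j′ {k} _)  = b₀ ∷ (k , j′) ∷ []
  supportOf (other {k} {c} _ _) = b₀ ∷ (k , c) ∷ []

  swap : ℕ × ℕ → ℕ × ℕ
  swap q = swapOf (kind q)

  swapOf-irrelevant : ∀ {q} (κ κ′ : Kind q) → swapOf κ ≡ swapOf κ′
  swapOf-irrelevant (inside-j _)       (inside-j _)       = refl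
  swapOf-irrelevant (inside-j k≤i)     (outside-j i<k)    = ⊥-elim (ℕ.<⇒≱ i<k k≤i)
  swapOf-irrelevant (inside-j _)       (other j≢j _)      = ⊥-elim (j≢j refl)
  swapOf-irrelevant (outside-j i<k)    (inside-j k≤i)     = ⊥-elim (ℕ.<⇒≱ i<k k≤i)
  swapOf-irrelevant (outside-j _)      (outside-j _)      = refl
  swapOf-irrelevant (outside-j _)      (other j≢j _)      = ⊥-elim (j≢j refl)
  swapOf-irrelevant (inside-j′ _)      (inside-j′ _)      = refl
  swapOf-irrelevant (inside-j′ k≤i)    (outside-j′ i<k)   = ⊥-elim (ℕ.<⇒≱ i<k k≤i)
  swapOf-irrelevant (inside-j′ _)      (other _ j′≢j′)    = ⊥-elim (j′≢j′ refl)
  swapOf-irrelevant (outside-j′ i<k)   (inside-j′ k≤i)    = ⊥-elim (ℕ.<⇒≱ i<k k≤i)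
  swapOf-irrelevant (outside-j′ _)     (outside-j′ _)     = refl
  swapOf-irrelevant (outside-j′ _)     (other _ j′≢j′)    = ⊥-elim (j′≢j′ refl)
  swapOf-irrelevant (other j≢j _)      (inside-j _)       = ⊥-elim (j≢j refl)
  swapOf-irrelevant (other j≢j _)      (outside-j _)      = ⊥-elim (j≢j refl)
  swapOf-irrelevant (other _ j′≢j′)    (inside-j′ _)      = ⊥-elim (j′≢j′ refl)
  swapOf-irrelevant (other _ j′≢j′)    (outside-j′ _)     = ⊥-elim (j′≢j′ refl)
  swapOf-irrelevant (other _ _)        (other _ _)        = refl

  swap-kind : ∀ {q} (κ : Kind q) → swap q ≡ swapOf κ
  swap-kind κ = swapOf-irrelevant (kind _) κ

  swap-involutive : ∀ q → swap (swap q) ≡ q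
  swap-involutive q = involutive (kind q)
    where
    involutive : ∀ {q} (κ : Kind q) → swap (swapOf κ) ≡ q
    involutive (inside-j k≤i)     = swap-kind (inside-j′ k≤i)
    involutive (outside-j i<k)    = swap-kind (outside-j i<k)
    involutive (inside-j′ k≤i)    = swap-kind (inside-j k≤i)
    involutive (outside-j′ i<k)   = swap-kind (outside-j′ i<k)
    involutive (other c≢j c≢j′)   = swap-kind (other c≢j c≢j′)

  column-j<ₗₑₓj′ : ∀ {k} → (k , j) <ₗₑₓ (k , j′)
  column-j<ₗₑₓj′ = inj₂ (refl , ℕ.n<1+n j)

  support-order : ∀ {q} (κ : Kind q) {y} → y ∈ supportOf κ → y ≡ b₀ ⊎ swap y ≡ q ⊎ q <ₗₑₓ swap y
  support-order (inside-j k≤i)   (here y≡b₀)                = inj₁ y≡b₀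
  support-order (inside-j k≤i)   (there (here refl))         = inj₂ (inj₂ (subst (_ <ₗₑₓ_) (sym (swap-kind (inside-j k≤i))) column-j<ₗₑₓj′))
  support-order (inside-j k≤i)   (there (there (here refl))) = inj₂ (inj₁ (swap-kind (inside-j′ k≤i)))
  support-order (outside-j i<k)  (here y≡b₀)                = inj₁ y≡b₀
  support-order (outside-j i<k)  (there (here refl))         = inj₂ (inj₁ (swap-kind (outside-j i<k)))
  support-order (outside-j i<k)  (there (there (here refl))) = inj₂ (inj₂ (subst (_ <ₗₑₓ_) (sym (swap-kind (outside-j′ i<k))) column-j<ₗₑₓj′))
  support-order (inside-j′ k≤i)  (here refl)                 = inj₂ (inj₁ (swap-kind (inside-j k≤i)))
  support-order (outside-j′ _)   (here y≡b₀)                = inj₁ y≡b₀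
  support-order (outside-j′ i<k) (there (here refl))         = inj₂ (inj₁ (swap-kind (outside-j′ i<k)))
  support-order (other _ _)      (here y≡b₀)                = inj₁ y≡b₀
  support-order (other c≢j c≢j′) (there (here refl))         = inj₂ (inj₁ (swap-kind (other c≢j c≢j′)))

  E : List (ℕ × ℕ)
  E = positionsExcept n b₀

  swap≢b₀ : ∀ {q} → q ∈ E → swap q ≢ b₀
  swap≢b₀ {q} q∈ = avoid (kind q) (∈-positionsExcept⁻ {n} q∈)
    where
    avoid : ∀ {q} (κ : Kind q) → q ∈ positions n × q ≢ b₀ → swapOf κ ≢ b₀
    avoid (inside-j _)   _                   k,j′≡b₀ = j≢j′ (sym (cong proj₂ k,j′≡b₀))
    avoid (outside-j i<k) _                  refl    = ℕ.<-asym i<k j<i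
    avoid (inside-j′ _)  (j,j′∈ , _)         refl    = ℕ.<-irrefl refl (proj₁ (proj₂ (∈-positions⁻ {n} j,j′∈)))
    avoid (outside-j′ _) _                   k,j′≡b₀ = j≢j′ (sym (cong proj₂ k,j′≡b₀))
    avoid (other c≢j _)  _                   refl    = c≢j refl

  later-off : ∀ {q₁ q₂} → q₁ ∈ E → q₁ <ₗₑₓ q₂ → swap q₁ ∉ supportOf (kind q₂)
  later-off {q₁} q₁∈ q₁<q₂ sq₁∈ with support-order (kind _) sq₁∈
  ... | inj₁ sq₁≡b₀        = swap≢b₀ q₁∈ sq₁≡b₀
  ... | inj₂ (inj₁ q₁≡q₂)  = <ₗₑₓ⇒≢ q₁<q₂ (trans (sym (swap-involutive q₁)) q₁≡q₂)
  ... | inj₂ (inj₂ q₂<q₁)  = <ₗₑₓ-asym q₁<q₂ (subst (_ <ₗₑₓ_) (swap-involutive q₁) q₂<q₁)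

  swap∈positions : ∀ {q} → q ∈ E → swap q ∈ positions n
  swap∈positions {q} q∈ = designate (kind q) (∈-positionsExcept⁻ {n} q∈)
    where
    designate : ∀ {q} (κ : Kind q) → q ∈ positions n × q ≢ b₀ → swapOf κ ∈ positions n
    designate (inside-j {k} _)  (k,j∈ , k,j≢b₀) with ∈-positions⁻ {n} k,j∈
    ... | _ , j≤k , k≤ = ∈-positions⁺ {n} (s≤s z≤n) (ℕ.≤∧≢⇒< j≤k (λ j≡k → k,j≢b₀ (cong (_, j) (sym j≡k)))) k≤
    designate (outside-j _)     (q∈ , _) = q∈
    designate (inside-j′ {k} _) (k,j′∈ , _) with ∈-positions⁻ {n} k,j′∈
    ... | _ , j′≤k , k≤ = ∈-positions⁺ {n} 1≤j (ℕ.≤-trans (ℕ.n≤1+n j) j′≤k) k≤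
    designate (outside-j′ _)    (q∈ , _) = q∈
    designate (other _ _)       (q∈ , _) = q∈

  point : ℕ × ℕ → Array
  point q = indicator (supportOf (kind q))

  point-at : ∀ q → entry (point q) (swap q) ≡ true
  point-at q = at (kind q)
    where
    at : ∀ {q} (κ : Kind q) → entry (indicator (supportOf κ)) (swapOf κ) ≡ true
    at κ@(inside-j _)   = indicator-∈ {supportOf κ} (there (there (here refl)))
    at κ@(outside-j _)  = indicator-∈ {supportOf κ} (there (here refl))
    at κ@(inside-j′ _)  = indicator-∈ {supportOf κ} (here refl)
    at κ@(outside-j′ _) = indicator-∈ {supportOf κ} (there (here refl))
    at κ@(other _ _)    = indicator-∈ {supportOf κ} (there (here refl))

  counts : ℕ → ℕ × ℕ → ℕ
  counts c q = bℕ (entry (indicator (segment c c i)) q)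

  onFace-by-columns : ∀ L → Unique L → IsTSSCPP n (indicator L) → ∀ b →
                      ∑ℕ L (counts j) ≡ suc b → ∑ℕ L (counts j′) ≡ b → OnFace n (inequalityFacet (i , j)) (indicator L)
  onFace-by-columns L !L L-tss b col-j col-j′ = L-tss , (begin
    dot n (proj₁ (inequalityFacet (i , j))) (indicator L)                              ≡⟨ dot-inequalityFacet n (indicator L) 1≤j i≤ ⟩
    toℚ (columnSum (indicator L) j j i) ℚ.- toℚ (columnSum (indicator L) j′ j′ i)     ≡⟨ cong₂ (λ a b → toℚ a ℚ.- toℚ b)
                                                                                           (trans (columnSum-indicator {j} {j} {i} L !L) col-j)
                                                                                           (trans (columnSum-indicator {j′} {j′} {i} L !L) col-j′) ⟩
    toℚ (suc b) ℚ.- toℚ b                                                             ≡⟨ toℚ-suc-diff b ⟩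
    1ℚ                                                                                ∎)
    where open ≡-Reasoning

  b₀-in-j : counts j b₀ ≡ 1
  b₀-in-j = in-segment {j} {j} {i} ℕ.≤-refl (ℕ.<⇒≤ j<i)

  in-column : ∀ c {k} → c ℕ.≤ k → k ℕ.≤ i → counts c (k , c) ≡ 1
  in-column c c≤k k≤i = in-segment {c} {c} {i} c≤k k≤i

  off : ∀ c {k c′} → c′ ≢ c → counts c (k , c′) ≡ 0
  off c c′≢c = off-column {c} {c} {i} c′≢c

  below : ∀ c {k c′} → i ℕ.< k → counts c (k , c′) ≡ 0
  below c i<k = below-segment {c} {c} {i} i<k

  j′≢j : j′ ≢ j
  j′≢j = j≢j′ ∘ sym

  support-on : ∀ {q} (κ : Kind q) → q ∈ positions n × q ≢ b₀ → OnFace n (inequalityFacet (i , j)) (indicator (supportOf κ))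
  support-on (inside-j {k} k≤i) (k,j∈ , k,j≢b₀) =
    onFace-by-columns _ (pair-unique j≢k) (pair-tss n j≢k j<k (ℕ.m≤n⊔m j k)) 1
      (cong₂ _+_ b₀-in-j (cong₂ _+_ (in-column j (ℕ.<⇒≤ j<k) k≤i) (cong (_+ 0) (off j j′≢j))))
      (cong₂ _+_ (off j′ j≢j′) (cong₂ _+_ (off j′ j≢j′) (cong (_+ 0) (in-column j′ j<k k≤i))))
    where
    j<k : j ℕ.< k
    j<k = ℕ.≤∧≢⇒< (proj₁ (proj₂ (∈-positions⁻ {n} k,j∈))) (λ j≡k → k,j≢b₀ (cong (_, j) (sym j≡k)))
    j≢k = ℕ.<⇒≢ j<k
  support-on (outside-j {k} i<k) _ =
    onFace-by-columns _ (pair-unique j≢k) (pair-tss n j≢k j<k (ℕ.m≤n⊔m j k)) 0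
      (cong₂ _+_ b₀-in-j (cong₂ _+_ (below j i<k) (cong (_+ 0) (off j j′≢j))))
      (cong₂ _+_ (off j′ j≢j′) (cong₂ _+_ (off j′ j≢j′) (cong (_+ 0) (below j′ i<k))))
    where
    j<k = ℕ.<-trans j<i i<k
    j≢k = ℕ.<⇒≢ j<k
  support-on (inside-j′ {k} k≤i) (k,j′∈ , _) =
    onFace-by-columns _ ([] ∷ []) (unit-tss n (k , j)) 0
      (cong (_+ 0) (in-column j (ℕ.<⇒≤ (proj₁ (proj₂ (∈-positions⁻ {n} k,j′∈)))) k≤i))
      (cong (_+ 0) (off j′ j≢j′))
  support-on (outside-j′ {k} i<k) _ =
    onFace-by-columns _ !L (sparse-tss n _ !L ((j≢j′ ∷ []) ∷ [] ∷ [])) 0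
      (cong₂ _+_ b₀-in-j (cong (_+ 0) (off j j′≢j)))
      (cong₂ _+_ (off j′ j≢j′) (cong (_+ 0) (below j′ i<k)))
    where !L = ((j≢j′ ∘ cong proj₂) ∷ []) ∷ [] ∷ []
  support-on (other {k} {c} c≢j c≢j′) _ =
    onFace-by-columns _ !L (sparse-tss n _ !L (((c≢j ∘ sym) ∷ []) ∷ [] ∷ [])) 0
      (cong₂ _+_ b₀-in-j (cong (_+ 0) (off j c≢j)))
      (cong₂ _+_ (off j′ j≢j′) (cong (_+ 0) (off j′ c≢j′)))
    where !L = (((c≢j ∘ sym) ∘ cong proj₂) ∷ []) ∷ [] ∷ []

  point-on : ∀ {q} → q ∈ E → OnFace n (inequalityFacet (i , j)) (point q)
  point-on {q} q∈ = support-on (kind q) (∈-positionsExcept⁻ {n} q∈)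

  base-on : OnFace n (inequalityFacet (i , j)) (indicator [ b₀ ])
  base-on = onFace-by-columns [ b₀ ] ([] ∷ []) (unit-tss n b₀) 0 (cong (_+ 0) b₀-in-j) (cong (_+ 0) (off j′ j≢j′))

  b₀∈ : b₀ ∈ positions n
  b₀∈ = ∈-positions⁺ {n} 1≤j ℕ.≤-refl (ℕ.≤-trans (ℕ.<⇒≤ j<i) i≤)

  coeff≢0 : coeff (proj₁ (inequalityFacet (i , j))) b₀ ≢ 0ℚ
  coeff≢0 coeff≡0 = ℚ.1≢0 (trans (sym coeff≡1) coeff≡0)
    where
    coeff≡1 : coeff (proj₁ (inequalityFacet (i , j))) b₀ ≡ 1ℚ
    coeff≡1 = trans (cong₂ ℚ._-_ (bℚ≡toℚ∘bℕ (entry (indicator (segment j j i)) b₀)) (bℚ≡toℚ∘bℕ (entry (indicator (segment j′ j′ i)) b₀)))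
                    (cong₂ (λ u v → toℚ u ℚ.- toℚ v) b₀-in-j (off j′ j≢j′))

  facet : DefinesFacet n (inequalityFacet (i , j))
  facet = triangular-facet n {inequalityFacet (i , j)} (inequalityFacet-valid n 1≤j j<i i≤) b₀∈ coeff≢0 (record
    { point       = point
    ; designated  = swap
    ; base        = indicator [ b₀ ]
    ; base-on     = base-on
    ; point-on    = point-on
    ; designated∈ = swap∈positions
    ; point-at    = λ {q} _ → point-at q
    ; later-off   = λ {q₁} {q₂} q₁∈ _ q₁<q₂ → indicator-∉ {supportOf (kind q₂)} (later-off q₁∈ q₁<q₂)
    ; base-off    = λ {q} q∈ → unit-∉ {b₀} {swap q} (swap≢b₀ q∈)
    })

inequalityFacet-facet : ∀ n {i j} → 1 ℕ.≤ j → j ℕ.< i → i ℕ.≤ n ∸ 1 → DefinesFacet n (inequalityFacet (i , j))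
inequalityFacet-facet n {i} {j} 1≤j j<i i≤ = InequalityFamily.facet n i j 1≤j j<i i≤

facets : ℕ → List (Functional × ℚ)
facets n = map lowerFacet (positions n) ++ map upperFacet (positions n) ++ map inequalityFacet (ineqIndices n)

facets-facets : ∀ n → All (DefinesFacet n) (facets n)
facets-facets n =
  All.++⁺ (All.map⁺ (All.tabulate (lowerFacet-facet n)))
          (All.++⁺ (All.map⁺ (All.tabulate (upperFacet-facet n)))
                   (All.map⁺ (All.tabulate (λ { {i , j} t∈ → let 1≤j , j<i , i≤ = ∈-ineqIndices⁻ {n} t∈
                                                            in inequalityFacet-facet n 1≤j j<i i≤ }))))

module _ (n : ℕ) where

  separates : ∀ h h′ x → OnFace n h x → ¬ OnFace n h′ x → ¬ SameFace n h h′
  separates _ _ x x-on ¬x-on′ same = ¬x-on′ (Equivalence.to (same x (proj₁ x-on)) x-on)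

  separates′ : ∀ h h′ x → ¬ OnFace n h x → OnFace n h′ x → ¬ SameFace n h h′
  separates′ _ _ x ¬x-on x-on′ same = ¬x-on (Equivalence.from (same x (proj₁ x-on′)) x-on′)

  on-lowerFacet : ∀ {q x} → q ∈ positions n → IsTSSCPP n x → entry x q ≡ false → OnFace n (lowerFacet q) x
  on-lowerFacet {q} {x} q∈ x-tss x[q]≡0 = x-tss , trans (dot-lowerFacet n x q∈) (cong (ℚ.-_ ∘ bℚ) x[q]≡0)

  off-lowerFacet : ∀ {q x} → q ∈ positions n → entry x q ≡ true → ¬ OnFace n (lowerFacet q) x
  off-lowerFacet {q} {x} q∈ x[q]≡1 (_ , -x[q]≡0) =
    ℚ.1≢0 (ℚ.neg-injective (trans (cong (ℚ.-_ ∘ bℚ) (sym x[q]≡1)) (trans (sym (dot-lowerFacet n x q∈)) -x[q]≡0)))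

  on-upperFacet : ∀ {q x} → q ∈ positions n → IsTSSCPP n x → entry x q ≡ true → OnFace n (upperFacet q) x
  on-upperFacet {q} {x} q∈ x-tss x[q]≡1 = x-tss , trans (dot-upperFacet n x q∈) (cong bℚ x[q]≡1)

  off-upperFacet : ∀ {q x} → q ∈ positions n → entry x q ≡ false → ¬ OnFace n (upperFacet q) x
  off-upperFacet {q} {x} q∈ x[q]≡0 (_ , x[q]≡1) =
    ℚ.1≢0 (sym (trans (cong bℚ (sym x[q]≡0)) (trans (sym (dot-upperFacet n x q∈)) x[q]≡1)))

  on-inequalityFacet : ∀ {i j k} → (i , j) ∈ ineqIndices n → j ℕ.≤ k → k ℕ.≤ i →
                       OnFace n (inequalityFacet (i , j)) (indicator [ (k , j) ])
  on-inequalityFacet {i} {j} {k} t∈ j≤k k≤i = unit-tss n (k , j) , (begin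
    dot n (proj₁ (inequalityFacet (i , j))) e                         ≡⟨ dot-inequalityFacet n e 1≤j i≤ ⟩
    toℚ (columnSum e j j i) ℚ.- toℚ (columnSum e (suc j) (suc j) i)   ≡⟨ cong₂ (λ a b → toℚ a ℚ.- toℚ b) column-j column-j+1 ⟩
    toℚ 1 ℚ.- toℚ 0                                                   ≡⟨⟩
    1ℚ                                                                ∎)
    where
    open ≡-Reasoning
    e = indicator [ (k , j) ]
    1≤j = proj₁ (∈-ineqIndices⁻ {n} t∈)
    i≤ = proj₂ (proj₂ (∈-ineqIndices⁻ {n} t∈))
    column-j : columnSum e j j i ≡ 1
    column-j = trans (columnSum-indicator {j} {j} {i} [ (k , j) ] ([] ∷ [])) (cong (_+ 0) (in-segment {j} {j} {i} j≤k k≤i))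
    column-j+1 : columnSum e (suc j) (suc j) i ≡ 0
    column-j+1 = trans (columnSum-indicator {suc j} {suc j} {i} [ (k , j) ] ([] ∷ []))
                       (cong (_+ 0) (off-column {suc j} {suc j} {i} {k} (ℕ.<⇒≢ (ℕ.n<1+n j))))

  off-inequalityFacet : ∀ {i j x} → (i , j) ∈ ineqIndices n → columnSum x j j i ≡ 0 → ¬ OnFace n (inequalityFacet (i , j)) x
  off-inequalityFacet {i} {j} {x} t∈ col-j≡0 (_ , value≡1) =
    -toℚ≢1 (columnSum x (suc j) (suc j) i)
           (trans (cong (λ a → toℚ a ℚ.- toℚ (columnSum x (suc j) (suc j) i)) (sym col-j≡0))
                  (trans (sym (dot-inequalityFacet n x (proj₁ (∈-ineqIndices⁻ {n} t∈)) (proj₂ (proj₂ (∈-ineqIndices⁻ {n} t∈))))) value≡1))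

  on-inequalityFacet⇒∈ : ∀ {i j p} → (i , j) ∈ ineqIndices n → OnFace n (inequalityFacet (i , j)) (indicator [ p ]) →
                          p ∈ segment j j i
  on-inequalityFacet⇒∈ {i} {j} {p} t∈ p-on with entry (indicator (segment j j i)) p in p∈?
  ... | true  = indicator-true⇒∈ p∈?
  ... | false = ⊥-elim (off-inequalityFacet t∈ (trans (columnSum-indicator {j} {j} {i} [ p ] ([] ∷ [])) (cong (λ b → bℕ b + 0) p∈?)) p-on)

  on-diagonal : ∀ {i j} → (i , j) ∈ ineqIndices n → OnFace n (inequalityFacet (i , j)) (indicator [ (j , j) ])
  on-diagonal t∈ = on-inequalityFacet t∈ ℕ.≤-refl (ℕ.<⇒≤ (proj₁ (proj₂ (∈-ineqIndices⁻ {n} t∈))))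

  on-bottom : ∀ {i j} → (i , j) ∈ ineqIndices n → OnFace n (inequalityFacet (i , j)) (indicator [ (i , j) ])
  on-bottom t∈ = on-inequalityFacet t∈ (ℕ.<⇒≤ (proj₁ (proj₂ (∈-ineqIndices⁻ {n} t∈)))) ℕ.≤-refl

  lower≢lower : ∀ {q q′} → q ∈ positions n → q′ ∈ positions n → q ≢ q′ → ¬ SameFace n (lowerFacet q) (lowerFacet q′)
  lower≢lower {q} {q′} q∈ q′∈ q≢q′ = separates (lowerFacet q) (lowerFacet q′) (indicator [ q′ ])
    (on-lowerFacet q∈ (unit-tss n q′) (unit-∉ q≢q′)) (off-lowerFacet q′∈ (unit-∈ q′))

  upper≢upper : ∀ {q q′} → q ∈ positions n → q′ ∈ positions n → q ≢ q′ → ¬ SameFace n (upperFacet q) (upperFacet q′)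
  upper≢upper {q} {q′} q∈ q′∈ q≢q′ = separates (upperFacet q) (upperFacet q′) (indicator [ q ])
    (on-upperFacet q∈ (unit-tss n q) (unit-∈ q)) (off-upperFacet q′∈ (unit-∉ (q≢q′ ∘ sym)))

  lower≢upper : ∀ {q q′} → q ∈ positions n → q′ ∈ positions n → ¬ SameFace n (lowerFacet q) (upperFacet q′)
  lower≢upper {q} {q′} q∈ q′∈ = separates (lowerFacet q) (upperFacet q′) (indicator [])
    (on-lowerFacet q∈ (zero-tss n) refl) (off-upperFacet q′∈ refl)

  lower≢inequality : ∀ {q t} → q ∈ positions n → t ∈ ineqIndices n → ¬ SameFace n (lowerFacet q) (inequalityFacet t)
  lower≢inequality {q} {i , j} q∈ t∈ = separates (lowerFacet q) (inequalityFacet (i , j)) (indicator [])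
    (on-lowerFacet q∈ (zero-tss n) refl) (off-inequalityFacet t∈ (columnSum-indicator {j} {j} {i} [] []))

  upper≢inequality : ∀ {q t} → q ∈ positions n → t ∈ ineqIndices n → ¬ SameFace n (upperFacet q) (inequalityFacet t)
  upper≢inequality {q} {i , j} q∈ t∈ with q ≟² (j , j)
  ... | yes refl = separates′ (upperFacet q) (inequalityFacet (i , j)) (indicator [ (i , j) ])
                     (off-upperFacet q∈ (unit-∉ {i , j} {j , j} (ℕ.<⇒≢ (proj₁ (proj₂ (∈-ineqIndices⁻ {n} t∈))) ∘ cong proj₁)))
                     (on-bottom t∈)
  ... | no  q≢b₀ = separates′ (upperFacet q) (inequalityFacet (i , j)) (indicator [ (j , j) ])
                     (off-upperFacet q∈ (unit-∉ {j , j} {q} q≢b₀)) (on-diagonal t∈)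

  inequality≢inequality : ∀ {t t′} → t ∈ ineqIndices n → t′ ∈ ineqIndices n → t ≢ t′ →
                          ¬ SameFace n (inequalityFacet t) (inequalityFacet t′)
  inequality≢inequality {i , j} {i′ , j′} t∈ t′∈ t≢t′ with j ℕ.≟ j′
  ... | no j≢j′ = separates (inequalityFacet (i , j)) (inequalityFacet (i′ , j′)) (indicator [ (j , j) ])
                    (on-diagonal t∈) (λ on′ → j≢j′ (proj₁ (∈-segment⁻ (on-inequalityFacet⇒∈ t′∈ on′))))
  ... | yes refl with ℕ.<-cmp i i′
  ...   | tri< i<i′ _ _ = separates′ (inequalityFacet (i , j)) (inequalityFacet (i′ , j)) (indicator [ (i′ , j) ])
                            (λ on → ℕ.<⇒≱ i<i′ (proj₂ (proj₂ (∈-segment⁻ (on-inequalityFacet⇒∈ t∈ on))))) (on-bottom t′∈)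
  ...   | tri≈ _ refl _ = ⊥-elim (t≢t′ refl)
  ...   | tri> _ _ i′<i = separates (inequalityFacet (i , j)) (inequalityFacet (i′ , j)) (indicator [ (i , j) ])
                            (on-bottom t∈) (λ on′ → ℕ.<⇒≱ i′<i (proj₂ (proj₂ (∈-segment⁻ (on-inequalityFacet⇒∈ t′∈ on′)))))

  facets-distinct : AllPairs (λ h h′ → ¬ SameFace n h h′) (facets n)
  facets-distinct =
    AllPairs.++⁺ (AllPairs.map⁺ (AllPairs-map∈ (positions-unique n) lower≢lower))
      (AllPairs.++⁺ (AllPairs.map⁺ (AllPairs-map∈ (positions-unique n) upper≢upper))
                    (AllPairs.map⁺ (AllPairs-map∈ (ineqIndices-unique n) inequality≢inequality))
                    (All.map⁺ (All.tabulate (λ q∈ → All.map⁺ (All.tabulate (upper≢inequality q∈))))))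
      (All.map⁺ (All.tabulate (λ q∈ → All.++⁺ (All.map⁺ (All.tabulate (lower≢upper q∈)))
                                              (All.map⁺ (All.tabulate (lower≢inequality q∈))))))

-- Integral decomposition of dilated points

∑-upTo-suc : ∀ (f : ℕ → ℕ) D → f 0 + ∑ℕ (upTo D) (f ∘ suc) ≡ ∑ℕ (upTo D) f + f D
∑-upTo-suc f D = begin
  f 0 + ∑ℕ (upTo D) (f ∘ suc)              ≡⟨ cong (f 0 +_) (ℕ-Sum.∑-map suc (upTo D) f) ⟨
  f 0 + ∑ℕ (map suc (upTo D)) f            ≡⟨ cong (λ xs → f 0 + ∑ℕ xs f) (List.map-upTo suc D) ⟩
  ∑ℕ (upTo (suc D)) f                      ≡⟨ cong (λ xs → ∑ℕ xs f) (List.applyUpTo-∷ʳ (λ x → x) D) ⟨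
  ∑ℕ (upTo D ++ [ D ]) f                   ≡⟨ ℕ-Sum.∑-++ (upTo D) [ D ] f ⟩
  ∑ℕ (upTo D) f + (f D + 0)                ≡⟨ cong (∑ℕ (upTo D) f +_) (ℕ.+-identityʳ (f D)) ⟩
  ∑ℕ (upTo D) f + f D                      ∎
  where open ≡-Reasoning

hermite : ∀ D .{{_ : ℕ.NonZero D}} a → ∑ℕ (upTo D) (λ t → (a + t) / D) ≡ a
hermite D zero    = ℕ-Sum.∑-zeros (upTo D) (λ t∈ → m<n⇒m/n≡0 (∈-upTo⁻ t∈))
hermite D (suc a) = ℕ.+-cancelˡ-≡ (a / D) _ _ (begin
  a / D + ∑ℕ (upTo D) (λ t → (suc a + t) / D)     ≡⟨ cong₂ _+_ (cong (_/ D) (ℕ.+-identityʳ a)) (ℕ-Sum.∑-cong (upTo D) (λ {t} _ → cong (_/ D) (ℕ.+-suc a t))) ⟨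
  (a + 0) / D + ∑ℕ (upTo D) (λ t → (a + suc t) / D) ≡⟨ ∑-upTo-suc (λ t → (a + t) / D) D ⟩
  ∑ℕ (upTo D) (λ t → (a + t) / D) + (a + D) / D   ≡⟨ cong₂ _+_ (hermite D a) a+D/D≡1+a/D ⟩
  a + (1 + a / D)                                 ≡⟨ ℕ.+-suc a (a / D) ⟩
  suc (a + a / D)                                 ≡⟨ cong suc (ℕ.+-comm a (a / D)) ⟩
  suc (a / D + a)                                 ≡⟨ ℕ.+-suc (a / D) a ⟨
  a / D + suc a                                   ∎)
  where
  open ≡-Reasoning
  a+D/D≡1+a/D : (a + D) / D ≡ 1 + a / D
  a+D/D≡1+a/D = trans (m/n≡1+[m∸n]/n (ℕ.m≤n+m D a)) (cong (λ z → 1 + z / D) (ℕ.m+n∸n≡m a D))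

-- Y lies in D times the polytope cut out by the listed inequalities.
record Scaled (n D : ℕ) (Y : ℕ × ℕ → ℕ) : Set where
  field
    bounded    : ∀ {q} → q ∈ positions n → Y q ℕ.≤ D
    inequality : ∀ i j → 1 ℕ.≤ j → j ℕ.< i → i ℕ.≤ n ∸ 1 →
                 columnSumOf Y j j i ℕ.≤ D + columnSumOf Y (suc j) (suc j) i

bℕ-< : ∀ {a b} → a ℕ.≤ b → b ℕ.≤ 1 + a → bℕ (does (a ℕ.<? b)) + a ≡ b
bℕ-< {a} {b} a≤b b≤1+a = by-cases (a ℕ.<? b)
  where
  by-cases : (a<?b : Dec (a ℕ.< b)) → bℕ (does a<?b) + a ≡ b
  by-cases (yes a<b) = ℕ.≤-antisym a<b b≤1+a
  by-cases (no  a≮b) = ℕ.≤-antisym a≤b (ℕ.≮⇒≥ a≮b)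

-- Rounding the partial column sums of Y / D with the D offsets t / D splits Y into D arrays.
module Rounding {n D : ℕ} .{{_ : ℕ.NonZero D}} {Y : ℕ × ℕ → ℕ} (Y∈DQ : Scaled n D Y) where

  open Scaled Y∈DQ

  partial : ℕ → ℕ → ℕ
  partial c k = columnSumOf Y c c k

  round : ℕ → ℕ → ℕ
  round t a = (a + t) / D

  part : ℕ → Array
  part t k c = does (round t (partial c (k ∸ 1)) ℕ.<? round t (partial c k))

  round-mono : ∀ t {a b} → a ℕ.≤ b → round t a ℕ.≤ round t b
  round-mono t a≤b = /-monoˡ-≤ D (ℕ.+-monoˡ-≤ t a≤b)

  round-D+ : ∀ t a → round t (D + a) ≡ 1 + round t a
  round-D+ t a = trans (m/n≡1+[m∸n]/n (ℕ.≤-trans (ℕ.m≤m+n D a) (ℕ.m≤m+n (D + a) t)))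
                       (cong (λ z → 1 + z / D) (trans (cong (_∸ D) (ℕ.+-assoc D a t)) (ℕ.m+n∸m≡n D (a + t))))

  partial-∷ʳ : ∀ {c k} → c ℕ.≤ suc k → partial c (suc k) ≡ partial c k + Y (suc k , c)
  partial-∷ʳ {c} {k} c≤1+k = trans (cong (λ ks → ∑ℕ ks (λ r → Y (r , c))) (range-∷ʳ c≤1+k))
                                    (trans (ℕ-Sum.∑-++ (range c k) [ suc k ] (λ r → Y (r , c)))
                                           (cong (partial c k +_) (ℕ.+-identityʳ (Y (suc k , c)))))

  part-step : ∀ t {c k} → (suc k , c) ∈ positions n →
              bℕ (part t (suc k) c) + round t (partial c k) ≡ round t (partial c (suc k))
  part-step t {c} {k} q∈ = bℕ-< (round-mono t (ℕ.≤-trans (ℕ.m≤m+n _ _) (ℕ.≤-reflexive (sym partial≡))))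
    (ℕ.≤-trans (round-mono t (ℕ.≤-trans (ℕ.≤-reflexive partial≡) (ℕ.≤-trans (ℕ.+-monoʳ-≤ (partial c k) (bounded q∈))
                                                                        (ℕ.≤-reflexive (ℕ.+-comm (partial c k) D)))))
               (ℕ.≤-reflexive (round-D+ t (partial c k))))
    where
    partial≡ : partial c (suc k) ≡ partial c k + Y (suc k , c)
    partial≡ = partial-∷ʳ (proj₁ (proj₂ (∈-positions⁻ {n} q∈)))

  round-0 : ∀ {t} → t ℕ.< D → round t 0 ≡ 0
  round-0 t<D = m<n⇒m/n≡0 t<D

  columnSum-part : ∀ {t} → t ℕ.< D → ∀ {c} → 1 ℕ.≤ c → ∀ i → i ℕ.≤ n ∸ 1 → columnSum (part t) c c i ≡ round t (partial c i)
  columnSum-part {t} t<D {c} 1≤c zero _ rewrite range-empty {c} {0} 1≤c = sym (round-0 t<D)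
  columnSum-part {t} t<D {c} 1≤c (suc i) 1+i≤ with c ℕ.≤? suc i
  ... | no  c≰1+i rewrite range-empty {c} {suc i} (ℕ.≰⇒> c≰1+i) = sym (round-0 t<D)
  ... | yes c≤1+i = begin
    columnSum (part t) c c (suc i)                          ≡⟨ cong (λ ks → ∑ℕ ks (λ k → bℕ (part t k c))) (range-∷ʳ c≤1+i) ⟩
    ∑ℕ (range c i ++ [ suc i ]) (λ k → bℕ (part t k c))     ≡⟨ ℕ-Sum.∑-++ (range c i) [ suc i ] (λ k → bℕ (part t k c)) ⟩
    columnSum (part t) c c i + (bℕ (part t (suc i) c) + 0)  ≡⟨ cong₂ _+_ (columnSum-part t<D 1≤c i (ℕ.≤-trans (ℕ.n≤1+n i) 1+i≤))
                                                                       (ℕ.+-identityʳ _) ⟩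
    round t (partial c i) + bℕ (part t (suc i) c)           ≡⟨ ℕ.+-comm (round t (partial c i)) _ ⟩
    bℕ (part t (suc i) c) + round t (partial c i)           ≡⟨ part-step t (∈-positions⁺ {n} 1≤c c≤1+i 1+i≤) ⟩
    round t (partial c (suc i))                             ∎
    where open ≡-Reasoning

  part-tss : ∀ {t} → t ℕ.< D → IsTSSCPP n (part t)
  part-tss {t} t<D i j 1≤j j<i i≤ = begin
    columnSum (part t) j j i                   ≡⟨ columnSum-part t<D 1≤j i i≤ ⟩
    round t (partial j i)                      ≤⟨ round-mono t (inequality i j 1≤j j<i i≤) ⟩
    round t (D + partial (suc j) i)            ≡⟨ round-D+ t (partial (suc j) i) ⟩
    1 + round t (partial (suc j) i)            ≡⟨ cong suc (columnSum-part t<D {suc j} (s≤s z≤n) i i≤) ⟨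
    1 + columnSum (part t) (suc j) (suc j) i   ∎
    where open ℕ.≤-Reasoning

  parts-sum : ∀ {q} → q ∈ positions n → ∑ℕ (upTo D) (λ t → bℕ (entry (part t) q)) ≡ Y q
  parts-sum {zero  , c} q∈ = ⊥-elim (ℕ.<-irrefl refl (ℕ.≤-trans (proj₁ (∈-positions⁻ {n} q∈)) (proj₁ (proj₂ (∈-positions⁻ {n} q∈)))))
  parts-sum {suc k , c} q∈ = ℕ.+-cancelʳ-≡ (partial c k) _ _ (begin
    ∑ℕ (upTo D) (λ t → bℕ (part t (suc k) c)) + partial c k
                                                  ≡⟨ cong (∑ℕ (upTo D) (λ t → bℕ (part t (suc k) c)) +_) (hermite D (partial c k)) ⟨
    ∑ℕ (upTo D) (λ t → bℕ (part t (suc k) c)) + ∑ℕ (upTo D) (λ t → round t (partial c k))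
                                                  ≡⟨ ℕ-Sum.∑-+ (upTo D) (λ t → bℕ (part t (suc k) c)) (λ t → round t (partial c k)) ⟨
    ∑ℕ (upTo D) (λ t → bℕ (part t (suc k) c) + round t (partial c k))
                                                  ≡⟨ ℕ-Sum.∑-cong (upTo D) (λ {t} _ → part-step t q∈) ⟩
    ∑ℕ (upTo D) (λ t → round t (partial c (suc k)))
                                                  ≡⟨ hermite D (partial c (suc k)) ⟩
    partial c (suc k)                             ≡⟨ partial-∷ʳ (proj₁ (proj₂ (∈-positions⁻ {n} q∈))) ⟩
    partial c k + Y (suc k , c)                   ≡⟨ ℕ.+-comm (partial c k) _ ⟩
    Y (suc k , c) + partial c k                   ∎)
    where open ≡-Reasoning

scaled-valid : ∀ {n D} .{{_ : ℕ.NonZero D}} {Y} → Scaled n D Y → ∀ {c β} → Valid n (c , β) →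
               ∑ℚ (positions n) (λ q → coeff c q ℚ.* toℚ (Y q)) ℚ.≤ toℚ D ℚ.* β
scaled-valid {n} {D} {Y} Y∈DQ {c} {β} valid = begin
  ∑ℚ (positions n) (λ q → coeff c q ℚ.* toℚ (Y q))
      ≡⟨ ℚ-Sum.∑-cong (positions n) (λ {q} q∈ → cong (coeff c q ℚ.*_) (Y≡∑parts q∈)) ⟩
  ∑ℚ (positions n) (λ q → coeff c q ℚ.* ∑ℚ (upTo D) (λ t → coordinate q (part t)))
      ≡⟨ ℚ-Sum.∑-cong (positions n) (λ {q} _ → ℚ-Sum.∑-*ˡ (upTo D) (coeff c q) (λ t → coordinate q (part t))) ⟨
  ∑ℚ (positions n) (λ q → ∑ℚ (upTo D) (λ t → coeff c q ℚ.* coordinate q (part t)))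
      ≡⟨ ℚ-Sum.∑-comm (positions n) (upTo D) (λ q t → coeff c q ℚ.* coordinate q (part t)) ⟩
  ∑ℚ (upTo D) (λ t → dot n c (part t))
      ≤⟨ ∑ℚ-mono-≤ (upTo D) (λ {t} t∈ → valid (part t) (part-tss (∈-upTo⁻ t∈))) ⟩
  ∑ℚ (upTo D) (λ _ → β)
      ≡⟨ ∑ℚ-const (upTo D) β ⟩
  toℚ (length (upTo D)) ℚ.* β
      ≡⟨ cong (λ l → toℚ l ℚ.* β) (List.length-upTo D) ⟩
  toℚ D ℚ.* β
      ∎
  where
  open ℚ.≤-Reasoning
  open Rounding Y∈DQ
  Y≡∑parts : ∀ {q} → q ∈ positions n → toℚ (Y q) ≡ ∑ℚ (upTo D) (λ t → coordinate q (part t))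
  Y≡∑parts {q} q∈ = trans (cong toℚ (sym (parts-sum q∈)))
    (trans (toℚ-∑ (upTo D) (λ t → bℕ (entry (part t) q))) (ℚ-Sum.∑-cong (upTo D) (λ {t} _ → sym (bℚ≡toℚ∘bℕ (entry (part t) q)))))

-- Every facet is listed

-- Witnesses for the strictness of every listed inequality force the whole polytope into the face.
module Interior (n : ℕ) {c : Functional} {β : ℚ} (valid : Valid n (c , β))
                (W : List Array) (W-on : All (OnFace n (c , β)) W) {m-1 : ℕ} (|W|≡m : length W ≡ suc m-1)
                (W-has-1 : ∀ {q} → q ∈ positions n → Any (λ v → entry v q ≡ true) W)
                (W-has-0 : ∀ {q} → q ∈ positions n → Any (λ v → entry v q ≡ false) W)
                (W-slack : ∀ i j → 1 ℕ.≤ j → j ℕ.< i → i ℕ.≤ n ∸ 1 →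
                           Any (λ v → columnSum v j j i ℕ.≤ columnSum v (suc j) (suc j) i) W)
                (w : Array) (w-tss : IsTSSCPP n w) where

  m K D : ℕ
  m = suc m-1
  K = m * suc (suc n)
  D = K * m

  -- Z is m times the barycentre of W, and Y / D = Z / m + (Z / m - w) / K lies in the listed polytope.
  Z Y : ℕ × ℕ → ℕ
  Z q = ∑ℕ W (λ v → bℕ (entry v q))
  Y q = suc K * Z q ∸ m * bℕ (entry w q)

  1≤Z : ∀ {q} → q ∈ positions n → 1 ℕ.≤ Z q
  1≤Z q∈ = ∑-≥ W (Any.map (λ v[q]≡1 → ℕ.≤-reflexive (cong bℕ (sym v[q]≡1))) (W-has-1 q∈))

  Z<m : ∀ {q} → q ∈ positions n → suc (Z q) ℕ.≤ m
  Z<m {q} q∈ = ℕ.≤-trans (∑-<-length+∑ W {g = λ _ → 0} (All.tabulate (λ {v} _ → bℕ≤1 (entry v q)))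
                                                        (Any.map (λ v[q]≡0 → ℕ.≤-reflexive (cong bℕ v[q]≡0)) (W-has-0 q∈)))
                         (ℕ.≤-reflexive (trans (cong₂ _+_ |W|≡m (ℕ-Sum.∑-zeros W (λ _ → refl))) (ℕ.+-identityʳ m)))

  m≤1+K : m ℕ.≤ suc K
  m≤1+K = ℕ.≤-trans (ℕ.m≤m*n m (suc (suc n))) (ℕ.n≤1+n K)

  Y+mw≡[1+K]Z : ∀ {q} → q ∈ positions n → Y q + m * bℕ (entry w q) ≡ suc K * Z q
  Y+mw≡[1+K]Z {q} q∈ = ℕ.m∸n+n≡m (begin
    m * bℕ (entry w q)  ≤⟨ ℕ.*-monoʳ-≤ m (bℕ≤1 (entry w q)) ⟩
    m * 1               ≡⟨ ℕ.*-identityʳ m ⟩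
    m                   ≤⟨ m≤1+K ⟩
    suc K               ≡⟨ ℕ.*-identityʳ (suc K) ⟨
    suc K * 1           ≤⟨ ℕ.*-monoʳ-≤ (suc K) (1≤Z q∈) ⟩
    suc K * Z q         ∎)
    where open ℕ.≤-Reasoning

  Y≤D : ∀ {q} → q ∈ positions n → Y q ℕ.≤ D
  Y≤D {q} q∈ = ℕ.≤-trans (ℕ.m∸n≤m (suc K * Z q) (m * bℕ (entry w q))) (ℕ.+-cancelʳ-≤ (suc K) _ _ (begin
    suc K * Z q + suc K    ≡⟨ cong (suc K * Z q +_) (ℕ.*-identityʳ (suc K)) ⟨
    suc K * Z q + suc K * 1 ≡⟨ ℕ.*-distribˡ-+ (suc K) (Z q) 1 ⟨
    suc K * (Z q + 1)      ≤⟨ ℕ.*-monoʳ-≤ (suc K) (ℕ.≤-trans (ℕ.≤-reflexive (ℕ.+-comm (Z q) 1)) (Z<m q∈)) ⟩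
    suc K * m              ≡⟨ ℕ.+-comm m D ⟩
    D + m                  ≤⟨ ℕ.+-monoʳ-≤ D m≤1+K ⟩
    D + suc K              ∎))
    where open ℕ.≤-Reasoning

  columnSum-Y : ∀ {c i} → 1 ℕ.≤ c → i ℕ.≤ n ∸ 1 →
                columnSumOf Y c c i + m * columnSum w c c i ≡ suc K * columnSumOf Z c c i
  columnSum-Y {c} {i} 1≤c i≤ = begin
    columnSumOf Y c c i + m * columnSum w c c i                           ≡⟨ cong (columnSumOf Y c c i +_) (ℕ-Sum.∑-*ˡ (range c i) m (λ k → bℕ (w k c))) ⟨
    columnSumOf Y c c i + ∑ℕ (range c i) (λ k → m * bℕ (w k c))           ≡⟨ ℕ-Sum.∑-+ (range c i) (λ k → Y (k , c)) (λ k → m * bℕ (w k c)) ⟨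
    ∑ℕ (range c i) (λ k → Y (k , c) + m * bℕ (w k c))                     ≡⟨ ℕ-Sum.∑-cong (range c i) (λ k∈ → Y+mw≡[1+K]Z
                                                                               (∈-positions⁺ {n} 1≤c (proj₁ (∈-range⁻ k∈)) (ℕ.≤-trans (proj₂ (∈-range⁻ k∈)) i≤))) ⟩
    ∑ℕ (range c i) (λ k → suc K * Z (k , c))                              ≡⟨ ℕ-Sum.∑-*ˡ (range c i) (suc K) (λ k → Z (k , c)) ⟩
    suc K * columnSumOf Z c c i                                           ∎
    where open ≡-Reasoning

  Z-slack : ∀ i j → 1 ℕ.≤ j → j ℕ.< i → i ℕ.≤ n ∸ 1 → suc (columnSumOf Z j j i) ℕ.≤ m + columnSumOf Z (suc j) (suc j) i
  Z-slack i j 1≤j j<i i≤ = subst₂ (λ a b → suc a ℕ.≤ b)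
    (sym (ℕ-Sum.∑-comm (range j i) W (λ k v → bℕ (v k j))))
    (cong₂ _+_ |W|≡m (sym (ℕ-Sum.∑-comm (range (suc j) i) W (λ k v → bℕ (v k (suc j))))))
    (∑-<-length+∑ W (All.map (λ {v} v-on → proj₁ v-on i j 1≤j j<i i≤) W-on) (W-slack i j 1≤j j<i i≤))

  Y-inequality : ∀ i j → 1 ℕ.≤ j → j ℕ.< i → i ℕ.≤ n ∸ 1 → columnSumOf Y j j i ℕ.≤ D + columnSumOf Y (suc j) (suc j) i
  Y-inequality i j 1≤j j<i i≤ = ℕ.≤-trans (ℕ.m≤m+n Yj (m * a)) (ℕ.+-cancelʳ-≤ (suc K) _ _ (begin
    Yj + m * a + suc K              ≡⟨ cong (_+ suc K) (columnSum-Y 1≤j i≤) ⟩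
    suc K * A + suc K               ≡⟨ cong (suc K * A +_) (ℕ.*-identityʳ (suc K)) ⟨
    suc K * A + suc K * 1           ≡⟨ ℕ.*-distribˡ-+ (suc K) A 1 ⟨
    suc K * (A + 1)                 ≤⟨ ℕ.*-monoʳ-≤ (suc K) (ℕ.≤-trans (ℕ.≤-reflexive (ℕ.+-comm A 1)) (Z-slack i j 1≤j j<i i≤)) ⟩
    suc K * (m + B)                 ≡⟨ ℕ.*-distribˡ-+ (suc K) m B ⟩
    suc K * m + suc K * B           ≡⟨ cong₂ _+_ (ℕ.+-comm m D) (sym (columnSum-Y {suc j} (s≤s z≤n) i≤)) ⟩
    (D + m) + (Yj′ + m * b)          ≡⟨ rearrange D m Yj′ (m * b) ⟩
    D + Yj′ + (m * b + m)            ≤⟨ ℕ.+-monoʳ-≤ (D + Yj′) mb+m≤1+K ⟩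
    D + Yj′ + suc K                  ∎))
    where
    open ℕ.≤-Reasoning
    Yj = columnSumOf Y j j i
    Yj′ = columnSumOf Y (suc j) (suc j) i
    A = columnSumOf Z j j i
    B = columnSumOf Z (suc j) (suc j) i
    a = columnSum w j j i
    b = columnSum w (suc j) (suc j) i
    rearrange : ∀ p q r s → (p + q) + (r + s) ≡ p + r + (s + q)
    rearrange = solve 4 (λ p q r s → (p :+ q) :+ (r :+ s) := p :+ r :+ (s :+ q)) refl
      where open ℕ-Solver.+-*-Solver
    b≤n : b ℕ.≤ n
    b≤n = ℕ.≤-trans (∑bℕ≤length (range (suc j) i) (λ k → w k (suc j)))
            (ℕ.≤-trans (ℕ.≤-reflexive (List.length-applyUpTo (suc j +_) (i ∸ j)))
                       (ℕ.≤-trans (ℕ.m∸n≤m i j) (ℕ.≤-trans i≤ (ℕ.m∸n≤m n 1))))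
    mb+m≤1+K : m * b + m ℕ.≤ suc K
    mb+m≤1+K = begin
      m * b + m          ≡⟨ cong (m * b +_) (ℕ.*-identityʳ m) ⟨
      m * b + m * 1      ≡⟨ ℕ.*-distribˡ-+ m b 1 ⟨
      m * (b + 1)        ≤⟨ ℕ.*-monoʳ-≤ m (ℕ.+-monoˡ-≤ 1 b≤n) ⟩
      m * (n + 1)        ≤⟨ ℕ.*-monoʳ-≤ m (ℕ.≤-trans (ℕ.≤-reflexive (ℕ.+-comm n 1)) (ℕ.n≤1+n (suc n))) ⟩
      K                  ≤⟨ ℕ.n≤1+n K ⟩
      suc K              ∎

  Y-scaled : Scaled n D Y
  Y-scaled = record { bounded = Y≤D ; inequality = Y-inequality }

  c·_ : (ℕ × ℕ → ℕ) → ℚ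
  c· X = ∑ℚ (positions n) (λ q → coeff c q ℚ.* toℚ (X q))

  c·Z≡mβ : c· Z ≡ toℚ m ℚ.* β
  c·Z≡mβ = begin
    c· Z                                                            ≡⟨ ℚ-Sum.∑-cong (positions n) (λ {q} _ → cong (coeff c q ℚ.*_) Z≡∑W) ⟩
    ∑ℚ (positions n) (λ q → coeff c q ℚ.* ∑ℚ W (coordinate q))      ≡⟨ ℚ-Sum.∑-cong (positions n) (λ {q} _ → ℚ-Sum.∑-*ˡ W (coeff c q) (coordinate q)) ⟨
    ∑ℚ (positions n) (λ q → ∑ℚ W (λ v → coeff c q ℚ.* coordinate q v)) ≡⟨ ℚ-Sum.∑-comm (positions n) W (λ q v → coeff c q ℚ.* coordinate q v) ⟩
    ∑ℚ W (dot n c)                                                  ≡⟨ ℚ-Sum.∑-cong W (λ v∈ → proj₂ (All.lookup W-on v∈)) ⟩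
    ∑ℚ W (λ _ → β)                                                  ≡⟨ ∑ℚ-const W β ⟩
    toℚ (length W) ℚ.* β                                            ≡⟨ cong (λ l → toℚ l ℚ.* β) |W|≡m ⟩
    toℚ m ℚ.* β                                                     ∎
    where
    open ≡-Reasoning
    Z≡∑W : ∀ {q} → toℚ (Z q) ≡ ∑ℚ W (coordinate q)
    Z≡∑W {q} = trans (toℚ-∑ W (λ v → bℕ (entry v q))) (ℚ-Sum.∑-cong W (λ {v} _ → sym (bℚ≡toℚ∘bℕ (entry v q))))

  c·Y+m[c·w]≡[1+K]mβ : c· Y ℚ.+ toℚ m ℚ.* dot n c w ≡ toℚ (suc K) ℚ.* (toℚ m ℚ.* β)
  c·Y+m[c·w]≡[1+K]mβ = begin
    c· Y ℚ.+ toℚ m ℚ.* dot n c w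
      ≡⟨ cong (c· Y ℚ.+_) (ℚ-Sum.∑-*ˡ (positions n) (toℚ m) (λ q → coeff c q ℚ.* coordinate q w)) ⟨
    c· Y ℚ.+ ∑ℚ (positions n) (λ q → toℚ m ℚ.* (coeff c q ℚ.* coordinate q w))
      ≡⟨ ℚ-Sum.∑-+ (positions n) (λ q → coeff c q ℚ.* toℚ (Y q)) (λ q → toℚ m ℚ.* (coeff c q ℚ.* coordinate q w)) ⟨
    ∑ℚ (positions n) (λ q → coeff c q ℚ.* toℚ (Y q) ℚ.+ toℚ m ℚ.* (coeff c q ℚ.* coordinate q w))
      ≡⟨ ℚ-Sum.∑-cong (positions n) (λ {q} q∈ → pointwise q∈) ⟩
    ∑ℚ (positions n) (λ q → toℚ (suc K) ℚ.* (coeff c q ℚ.* toℚ (Z q)))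
      ≡⟨ ℚ-Sum.∑-*ˡ (positions n) (toℚ (suc K)) (λ q → coeff c q ℚ.* toℚ (Z q)) ⟩
    toℚ (suc K) ℚ.* c· Z
      ≡⟨ cong (toℚ (suc K) ℚ.*_) c·Z≡mβ ⟩
    toℚ (suc K) ℚ.* (toℚ m ℚ.* β)
      ∎
    where
    open ≡-Reasoning
    open ℚ-Solver.+-*-Solver
    pointwise : ∀ {q} → q ∈ positions n →
      coeff c q ℚ.* toℚ (Y q) ℚ.+ toℚ m ℚ.* (coeff c q ℚ.* coordinate q w) ≡ toℚ (suc K) ℚ.* (coeff c q ℚ.* toℚ (Z q))
    pointwise {q} q∈ = begin
      coeff c q ℚ.* toℚ (Y q) ℚ.+ toℚ m ℚ.* (coeff c q ℚ.* coordinate q w)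
        ≡⟨ solve 4 (λ a y k x → a :* y :+ k :* (a :* x) := a :* (y :+ k :* x)) refl (coeff c q) (toℚ (Y q)) (toℚ m) (coordinate q w) ⟩
      coeff c q ℚ.* (toℚ (Y q) ℚ.+ toℚ m ℚ.* coordinate q w)
        ≡⟨ cong (λ x → coeff c q ℚ.* (toℚ (Y q) ℚ.+ toℚ m ℚ.* x)) (bℚ≡toℚ∘bℕ (entry w q)) ⟩
      coeff c q ℚ.* (toℚ (Y q) ℚ.+ toℚ m ℚ.* toℚ (bℕ (entry w q)))
        ≡⟨ cong (λ x → coeff c q ℚ.* (toℚ (Y q) ℚ.+ x)) (toℚ-* m (bℕ (entry w q))) ⟨
      coeff c q ℚ.* (toℚ (Y q) ℚ.+ toℚ (m * bℕ (entry w q)))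
        ≡⟨ cong (coeff c q ℚ.*_) (toℚ-+ (Y q) (m * bℕ (entry w q))) ⟨
      coeff c q ℚ.* toℚ (Y q + m * bℕ (entry w q))
        ≡⟨ cong (λ x → coeff c q ℚ.* toℚ x) (Y+mw≡[1+K]Z q∈) ⟩
      coeff c q ℚ.* toℚ (suc K * Z q)
        ≡⟨ cong (coeff c q ℚ.*_) (toℚ-* (suc K) (Z q)) ⟩
      coeff c q ℚ.* (toℚ (suc K) ℚ.* toℚ (Z q))
        ≡⟨ solve 3 (λ a k z → a :* (k :* z) := k :* (a :* z)) refl (coeff c q) (toℚ (suc K)) (toℚ (Z q)) ⟩
      toℚ (suc K) ℚ.* (coeff c q ℚ.* toℚ (Z q))
        ∎

  on-face : dot n c w ≡ β
  on-face with ℚ.<-cmp (dot n c w) β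
  ... | tri≈ _ c·w≡β _ = c·w≡β
  ... | tri> _ _ β<c·w = ⊥-elim (ℚ.<-irrefl refl (ℚ.≤-<-trans (valid w w-tss) β<c·w))
  ... | tri< c·w<β _ _ = ⊥-elim (ℚ.<-irrefl refl (begin-strict
    toℚ (suc K) ℚ.* (toℚ m ℚ.* β)           ≡⟨ c·Y+m[c·w]≡[1+K]mβ ⟨
    c· Y ℚ.+ toℚ m ℚ.* dot n c w            ≤⟨ ℚ.+-monoˡ-≤ (toℚ m ℚ.* dot n c w) (scaled-valid Y-scaled {c} valid) ⟩
    toℚ D ℚ.* β ℚ.+ toℚ m ℚ.* dot n c w     <⟨ ℚ.+-monoʳ-< (toℚ D ℚ.* β) (ℚ.*-monoʳ-<-pos (toℚ m) c·w<β) ⟩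
    toℚ D ℚ.* β ℚ.+ toℚ m ℚ.* β             ≡⟨ cong (λ d → d ℚ.* β ℚ.+ toℚ m ℚ.* β) (toℚ-* K m) ⟩
    toℚ K ℚ.* toℚ m ℚ.* β ℚ.+ toℚ m ℚ.* β   ≡⟨ solve 3 (λ k m b → k :* m :* b :+ m :* b := (con 1ℚ :+ k) :* (m :* b)) refl (toℚ K) (toℚ m) β ⟩
    toℚ (suc K) ℚ.* (toℚ m ℚ.* β)           ∎))
    where
    open ℚ.≤-Reasoning
    open ℚ-Solver.+-*-Solver
    instance
      m-positive : ℚ.Positive (toℚ m)
      m-positive = ℚ.positive (toℚ-positive m-1)

affRank-unique : ∀ {n S k₁ k₂} → AffRank n S k₁ → AffRank n S k₂ → k₁ ≡ k₂
affRank-unique ((ps₁ , S-ps₁ , |ps₁| , ind₁) , bound₁) ((ps₂ , S-ps₂ , |ps₂| , ind₂) , bound₂) =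
  ℕ.≤-antisym (subst (ℕ._≤ _) |ps₁| (bound₂ ps₁ S-ps₁ ind₁)) (subst (ℕ._≤ _) |ps₂| (bound₁ ps₂ S-ps₂ ind₂))

InequalityHolds : Array → ℕ × ℕ → Set
InequalityHolds x (i , j) = columnSum x j j i ℕ.≤ 1 + columnSum x (suc j) (suc j) i

tss? : ∀ n x → Dec (IsTSSCPP n x)
tss? n x = map′ from-all to-all (All.all? (λ { (i , j) → columnSum x j j i ℕ.≤? 1 + columnSum x (suc j) (suc j) i }) (ineqIndices n))
  where
  from-all : All (InequalityHolds x) (ineqIndices n) → IsTSSCPP n x
  from-all holds i j 1≤j j<i i≤ = All.lookup holds (∈-ineqIndices⁺ {n} 1≤j j<i i≤)
  to-all : IsTSSCPP n x → All (InequalityHolds x) (ineqIndices n)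
  to-all x-tss = All.tabulate (λ { {i , j} t∈ → let 1≤j , j<i , i≤ = ∈-ineqIndices⁻ {n} t∈ in x-tss i j 1≤j j<i i≤ })

Agree : List (ℕ × ℕ) → Array → Array → Set
Agree L x y = ∀ {q} → q ∈ L → entry x q ≡ entry y q

update : Array → ℕ × ℕ → Bool → Array
update x q b i j = if does ((i , j) ≟² q) then b else x i j

update-at : ∀ x q b → entry (update x q b) q ≡ b
update-at x q b = cong (λ d → if d then b else entry x q) (dec-true (q ≟² q) refl)

-- Enumerating the 0/1 assignments on the positions decides whether a face lies in a hyperplane.
arrays : List (ℕ × ℕ) → List Array
arrays []       = [ indicator [] ]
arrays (q ∷ qs) = concatMap (λ x → update x q true ∷ update x q false ∷ []) (arrays qs)

arrays-complete : ∀ L x → ∃ λ x′ → x′ ∈ arrays L × Agree L x′ x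
arrays-complete []       x = indicator [] , here refl , λ ()
arrays-complete (q ∷ qs) x with arrays-complete qs x
... | x′ , x′∈ , x′≈x =
  update x′ q (entry x q) ,
  ∈-concatMap⁺ (λ y → update y q true ∷ update y q false ∷ []) (Any.map (λ { refl → both (entry x q) }) x′∈) ,
  agree
  where
  both : ∀ b → update x′ q b ∈ update x′ q true ∷ update x′ q false ∷ []
  both true  = here refl
  both false = there (here refl)
  agree : Agree (q ∷ qs) (update x′ q (entry x q)) x
  agree (here refl) = update-at x′ q (entry x q)
  agree {p} (there p∈qs) with p ≟² q
  ... | yes refl = refl
  ... | no  _    = x′≈x p∈qs

dot-agree : ∀ n c {x y} → Agree (positions n) x y → dot n c x ≡ dot n c y
dot-agree n c x≈y = ℚ-Sum.∑-cong (positions n) (λ {q} q∈ → cong (λ b → coeff c q ℚ.* bℚ b) (x≈y q∈))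

tss-agree : ∀ n {x y} → Agree (positions n) x y → IsTSSCPP n x → IsTSSCPP n y
tss-agree n {x} {y} x≈y x-tss i j 1≤j j<i i≤ =
  subst₂ ℕ._≤_ (column-agree {j} 1≤j) (cong suc (column-agree {suc j} (s≤s z≤n))) (x-tss i j 1≤j j<i i≤)
  where
  column-agree : ∀ {c} → 1 ℕ.≤ c → columnSum x c c i ≡ columnSum y c c i
  column-agree 1≤c = ℕ-Sum.∑-cong (range _ i) (λ k∈ → cong bℕ (x≈y (∈-positions⁺ {n} 1≤c (proj₁ (∈-range⁻ k∈)) (ℕ.≤-trans (proj₂ (∈-range⁻ k∈)) i≤))))

search : ∀ n (P : Array → Set) → (∀ x → Dec (P x)) → (∀ {x y} → Agree (positions n) x y → P x → P y) →
         (∀ x → P x) ⊎ ∃ (¬_ ∘ P)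
search n P P? respects with All.all? P? (arrays (positions n))
... | yes all-P = inj₁ (λ x → let x′ , x′∈ , x′≈x = arrays-complete (positions n) x in respects x′≈x (All.lookup all-P x′∈))
... | no ¬all-P = inj₂ (let x , _ , ¬Px = find (All.¬All⇒Any¬ P? (arrays (positions n)) ¬all-P) in x , ¬Px)

NonzeroCoeff : ℕ → Functional × ℚ → Set
NonzeroCoeff n (c , _) = ∃ λ p₀ → p₀ ∈ positions n × coeff c p₀ ≢ 0ℚ

facets-nonzero : ∀ n → All (NonzeroCoeff n) (facets n)
facets-nonzero n =
  All.++⁺ (All.map⁺ (All.tabulate (λ {q} q∈ → q , q∈ , lowerFacet-coeff q)))
          (All.++⁺ (All.map⁺ (All.tabulate (λ {q} q∈ → q , q∈ , upperFacet-coeff q)))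
                   (All.map⁺ (All.tabulate (λ { {i , j} t∈ → let 1≤j , j<i , i≤ = ∈-ineqIndices⁻ {n} t∈
                                                             in (j , j) , InequalityFamily.b₀∈ n i j 1≤j j<i i≤ , InequalityFamily.coeff≢0 n i j 1≤j j<i i≤ }))))

module Completeness (n : ℕ) {c : Functional} {β : ℚ} (facet : DefinesFacet n (c , β)) where

  d : ℕ
  d = length (positions n)

  valid : Valid n (c , β)
  valid = proj₁ facet

  private
    k = proj₁ (proj₂ facet)
    face-rank = proj₁ (proj₂ (proj₂ (proj₂ facet)))
    k≡d : k ≡ d
    k≡d = ℕ.suc-injective (affRank-unique {n} (proj₂ (proj₂ (proj₂ (proj₂ facet)))) (polytope-rank n))
    ps = proj₁ (proj₁ face-rank)
    ps-on = proj₁ (proj₂ (proj₁ face-rank))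
    |ps|≡d = trans (proj₁ (proj₂ (proj₂ (proj₁ face-rank)))) k≡d
    ps-ind = proj₂ (proj₂ (proj₂ (proj₁ face-rank)))
    face-bound = proj₂ face-rank

  -- The face has d affinely independent vertices, so a hyperplane containing it is its affine hull.
  tight⇒same : ∀ {h′} → NonzeroCoeff n h′ → (∀ x → OnFace n (c , β) x → dot n (proj₁ h′) x ≡ proj₂ h′) → SameFace n (c , β) h′
  tight⇒same {c′ , β′} (p₀ , p₀∈ , c′[p₀]≢0) tight x x-tss =
    mk⇔ (λ x-on → x-tss , tight x x-on)
        (λ { (_ , x-on′) → x-tss , hyperplane-spanned n c′ β′ p₀∈ c′[p₀]≢0 ps |ps|≡d ps-ind (All.map (tight _) ps-on)
                                                      c β (All.map proj₂ ps-on) x x-on′ })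

  Witness : Functional × ℚ → Set
  Witness (c′ , β′) = ∃ λ x → OnFace n (c , β) x × dot n c′ x ≢ β′

  same-or-witness : ∀ h′ → NonzeroCoeff n h′ → SameFace n (c , β) h′ ⊎ Witness h′
  same-or-witness (c′ , β′) nonzero with search n P P? respects
    where
    P : Array → Set
    P x = IsTSSCPP n x → dot n c x ≡ β → dot n c′ x ≡ β′
    P? : ∀ x → Dec (P x)
    P? x = tss? n x →-dec (dot n c x ℚ.≟ β →-dec dot n c′ x ℚ.≟ β′)
    respects : ∀ {x y} → Agree (positions n) x y → P x → P y
    respects x≈y Px y-tss c·y≡β = trans (sym (dot-agree n c′ x≈y))
      (Px (tss-agree n (sym ∘ x≈y) y-tss) (trans (dot-agree n c x≈y) c·y≡β))
  ... | inj₁ tight       = inj₁ (tight⇒same nonzero (λ x x-on → tight x (proj₁ x-on) (proj₂ x-on)))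
  ... | inj₂ (x , ¬tight) with tss? n x | dot n c x ℚ.≟ β
  ...   | yes x-tss | yes c·x≡β = inj₂ (x , (x-tss , c·x≡β) , λ c′·x≡β′ → ¬tight (λ _ _ → c′·x≡β′))
  ...   | no ¬x-tss | _         = ⊥-elim (¬tight (λ x-tss → ⊥-elim (¬x-tss x-tss)))
  ...   | _         | no c·x≢β  = ⊥-elim (¬tight (λ _ c·x≡β → ⊥-elim (c·x≢β c·x≡β)))

  classify : ∀ L → All (NonzeroCoeff n) L → Any (SameFace n (c , β)) L ⊎ All Witness L
  classify []       []           = inj₂ []
  classify (h′ ∷ L) (nz ∷ nzs) with same-or-witness h′ nz | classify L nzs
  ... | inj₁ same | _          = inj₁ (here same)
  ... | inj₂ _    | inj₁ same  = inj₁ (there same)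
  ... | inj₂ wit  | inj₂ wits  = inj₂ (wit ∷ wits)

  witnesses : ∀ {L} → All Witness L → List Array
  witnesses []         = []
  witnesses (wit ∷ ws) = proj₁ wit ∷ witnesses ws

  witnesses-on : ∀ {L} (ws : All Witness L) → All (OnFace n (c , β)) (witnesses ws)
  witnesses-on []                    = []
  witnesses-on ((_ , x-on , _) ∷ ws) = x-on ∷ witnesses-on ws

  length-witnesses : ∀ {L} (ws : All Witness L) → length (witnesses ws) ≡ length L
  length-witnesses []        = refl
  length-witnesses (_ ∷ ws)  = cong suc (length-witnesses ws)

  witness-for : ∀ {L h′} (ws : All Witness L) → h′ ∈ L →
                Any (λ v → IsTSSCPP n v × dot n (proj₁ h′) v ≢ proj₂ h′) (witnesses ws)
  witness-for ((_ , (x-tss , _) , off) ∷ _)  (here refl) = here (x-tss , off)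
  witness-for (_ ∷ ws)                        (there h′∈) = there (witness-for ws h′∈)

  module _ (ws : All Witness (facets n)) where

    private
      W = witnesses ws

    W-has-1 : ∀ {q} → q ∈ positions n → Any (λ v → entry v q ≡ true) W
    W-has-1 {q} q∈ = Any.map (λ {v} (_ , off) → true-unless-false (entry v q) (off ∘ trans (dot-lowerFacet n v q∈) ∘ cong (ℚ.-_ ∘ bℚ)))
                             (witness-for ws (∈-++⁺ˡ (∈-map⁺ lowerFacet q∈)))

    W-has-0 : ∀ {q} → q ∈ positions n → Any (λ v → entry v q ≡ false) W
    W-has-0 {q} q∈ = Any.map (λ {v} (_ , off) → false-unless-true (entry v q) (off ∘ trans (dot-upperFacet n v q∈) ∘ cong bℚ))
                             (witness-for ws (∈-++⁺ʳ (map lowerFacet (positions n)) (∈-++⁺ˡ (∈-map⁺ upperFacet q∈))))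

    W-slack : ∀ i j → 1 ℕ.≤ j → j ℕ.< i → i ℕ.≤ n ∸ 1 → Any (λ v → columnSum v j j i ℕ.≤ columnSum v (suc j) (suc j) i) W
    W-slack i j 1≤j j<i i≤ =
      Any.map (λ {v} (v-tss , off) → slack (v-tss i j 1≤j j<i i≤) (off ∘ trans (dot-inequalityFacet n v 1≤j i≤)))
              (witness-for ws (∈-++⁺ʳ (map lowerFacet (positions n)) (∈-++⁺ʳ (map upperFacet (positions n))
                                      (∈-map⁺ inequalityFacet (∈-ineqIndices⁺ {n} 1≤j j<i i≤)))))
      where
      slack : ∀ {a b} → a ℕ.≤ 1 + b → toℚ a ℚ.- toℚ b ≢ 1ℚ → a ℕ.≤ b
      slack {a} {b} a≤1+b a-b≢1 with a ℕ.≟ suc b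
      ... | yes refl  = ⊥-elim (a-b≢1 (toℚ-suc-diff b))
      ... | no  a≢1+b = ℕ.≤-pred (ℕ.≤∧≢⇒< a≤1+b a≢1+b)

    |W|≡1+pred : length W ≡ suc (ℕ.pred (length W))
    |W|≡1+pred = sym (ℕ.suc-pred (length W) {{ℕ.>-nonZero (subst (0 ℕ.<_) (sym (length-witnesses ws))
                                                                (∈-length (∈-++⁺ˡ (∈-map⁺ lowerFacet p₀∈))))}})
      where
      p₀∈ = proj₂ (nonempty {xs = positions n} (ℕ.≤-trans (proj₁ (proj₂ (proj₂ facet))) (ℕ.≤-reflexive k≡d)))

    no-witnesses : ⊥
    no-witnesses = ℕ.<-irrefl refl (begin-strict
      d                          <⟨ ℕ.n<1+n d ⟩
      suc d                      ≡⟨ length-family (indicator ∘ [_]) (positions n) (indicator []) ⟨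
      length (unitPoints n)      ≤⟨ face-bound (unitPoints n) (All.map (λ w-tss → w-tss , on-face _ w-tss) (unitPoints-tss n))
                                               (unitPoints-affInd n) ⟩
      k                          ≡⟨ k≡d ⟩
      d                          ∎)
      where
      open ℕ.≤-Reasoning
      on-face : ∀ w → IsTSSCPP n w → dot n c w ≡ β
      on-face = Interior.on-face n {c} {β} valid W (witnesses-on ws) |W|≡1+pred W-has-1 W-has-0 W-slack

  complete : Any (SameFace n (c , β)) (facets n)
  complete with classify (facets n) (facets-nonzero n)
  ... | inj₁ same = same
  ... | inj₂ ws   = ⊥-elim (no-witnesses ws)

∑-id : ℕ → ℕ
∑-id m = ∑ℕ (range 1 m) (λ i → i)

gauss : ∀ m → 2 * ∑-id m ≡ m * suc m
gauss zero    = refl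
gauss (suc m) = begin
  2 * ∑-id (suc m)                ≡⟨ cong (λ is → 2 * ∑ℕ is (λ i → i)) (range-∷ʳ {1} {m} (s≤s z≤n)) ⟩
  2 * ∑ℕ (range 1 m ∷ʳ suc m) (λ i → i)  ≡⟨ cong (2 *_) (ℕ-Sum.∑-++ (range 1 m) [ suc m ] (λ i → i)) ⟩
  2 * (∑-id m + (suc m + 0))      ≡⟨ ℕ.*-distribˡ-+ 2 (∑-id m) (suc m + 0) ⟩
  2 * ∑-id m + 2 * (suc m + 0)    ≡⟨ cong (_+ 2 * (suc m + 0)) (gauss m) ⟩
  m * suc m + 2 * (suc m + 0)     ≡⟨ solve 1 (λ m → m :* (con 1 :+ m) :+ con 2 :* ((con 1 :+ m) :+ con 0) := (con 1 :+ m) :* (con 2 :+ m)) refl m ⟩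
  suc m * suc (suc m)             ∎
  where
  open ≡-Reasoning
  open ℕ-Solver.+-*-Solver

∑-pred+m≡∑-id : ∀ m → ∑ℕ (range 1 m) (_∸ 1) + m ≡ ∑-id m
∑-pred+m≡∑-id m = begin
  ∑ℕ (range 1 m) (_∸ 1) + m                              ≡⟨ cong (∑ℕ (range 1 m) (_∸ 1) +_) |range|≡m ⟨
  ∑ℕ (range 1 m) (_∸ 1) + ∑ℕ (range 1 m) (λ _ → 1)        ≡⟨ ℕ-Sum.∑-+ (range 1 m) (_∸ 1) (λ _ → 1) ⟨
  ∑ℕ (range 1 m) (λ i → i ∸ 1 + 1)                       ≡⟨ ℕ-Sum.∑-cong (range 1 m) (λ {i} i∈ → ℕ.m∸n+n≡m (proj₁ (∈-range⁻ i∈))) ⟩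
  ∑-id m                                                 ∎
  where
  open ≡-Reasoning
  |range|≡m : ∑ℕ (range 1 m) (λ _ → 1) ≡ m
  |range|≡m = trans (ones (range 1 m)) (List.length-applyUpTo (1 +_) m)
    where
    ones : ∀ (xs : List ℕ) → ∑ℕ xs (λ _ → 1) ≡ length xs
    ones []       = refl
    ones (_ ∷ xs) = cong suc (ones xs)

length-facets : ∀ m → length (facets (suc m)) * 2 ≡ m * (3 * suc m ∸ 2)
length-facets m = ℕ.+-cancelʳ-≡ (2 * m) _ _ (begin
  length (facets (suc m)) * 2 + 2 * m                   ≡⟨ cong (λ l → l * 2 + 2 * m) length≡ ⟩
  (s + (s + t)) * 2 + 2 * m                             ≡⟨ cong (λ s → (s + (s + t)) * 2 + 2 * m) (∑-pred+m≡∑-id m) ⟨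
  ((t + m) + ((t + m) + t)) * 2 + 2 * m                 ≡⟨ solve 2 (λ t m → ((t :+ m) :+ ((t :+ m) :+ t)) :* con 2 :+ con 2 :* m := con 3 :* (con 2 :* (t :+ m))) refl t m ⟩
  3 * (2 * (t + m))                                     ≡⟨ cong (λ s → 3 * (2 * s)) (∑-pred+m≡∑-id m) ⟩
  3 * (2 * s)                                           ≡⟨ cong (3 *_) (gauss m) ⟩
  3 * (m * suc m)                                       ≡⟨ solve 1 (λ m → con 3 :* (m :* (con 1 :+ m)) := m :* (con 3 :* m :+ con 1) :+ con 2 :* m) refl m ⟩
  m * (3 * m + 1) + 2 * m                               ≡⟨ cong (λ z → m * z + 2 * m) 3[1+m]∸2≡3m+1 ⟨
  m * (3 * suc m ∸ 2) + 2 * m                           ∎)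
  where
  open ≡-Reasoning
  open ℕ-Solver.+-*-Solver
  s = ∑-id m
  t = ∑ℕ (range 1 m) (_∸ 1)
  length≡ : length (facets (suc m)) ≡ s + (s + t)
  length≡ = trans (List.length-++ (map lowerFacet (positions (suc m))))
    (cong₂ _+_ (trans (List.length-map lowerFacet (positions (suc m))) (length-staircase (λ i → i) m))
      (trans (List.length-++ (map upperFacet (positions (suc m))))
        (cong₂ _+_ (trans (List.length-map upperFacet (positions (suc m))) (length-staircase (λ i → i) m))
                   (trans (List.length-map inequalityFacet (ineqIndices (suc m))) (length-staircase (_∸ 1) m)))))
  3[1+m]∸2≡3m+1 : 3 * suc m ∸ 2 ≡ 3 * m + 1
  3[1+m]∸2≡3m+1 = cong (_∸ 2) (solve 1 (λ m → con 3 :* (con 1 :+ m) := con 2 :+ (con 3 :* m :+ con 1)) refl m)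

theorem5p4 : (n : ℕ) → 1 ≤ n → NumFacets n (((n ∸ 1) * (3 * n ∸ 2)) / 2)
theorem5p4 (suc m) _ =
  facets (suc m) ,
  trans (sym (m*n/n≡m (length (facets (suc m))) 2)) (cong (_/ 2) (length-facets m)) ,
  facets-facets (suc m) ,
  facets-distinct (suc m) ,
  λ h h-facet → Completeness.complete (suc m) {proj₁ h} {proj₂ h} h-facet
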